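{- Let $H$ be the oriented graph on vertex set $\{a_1,a_2,b,c\}$ whose arcs are exactly $a_1\to b$, $a_2\to b$, $b\to c$, $c\to a_1$, $c\to a_2$ (so $a_1$ and $a_2$ are non-adjacent). Then $I(H)=\frac49$.
   Context: An oriented graph is a finite simple graph together with an orientation of each edge (no loops, no multiple edges, no 2-cycles). For oriented graphs $H$ on $k$ vertices and $G$, let $N(H,G)$ be the number of $k$-element subsets of $V(G)$ that induce an oriented graph isomorphic to $H$. The inducibility of $H$ is $I(H)=\lim_{n\to\infty}\max\{N(H,G): G \text{ an oriented graph with } |V(G)|=n\}/\binom{n}{k}$. -}

module Defs where

open import Data.Nat using (ℕ; zero; suc; _<ᵇ_)
open import Data.Nat.Combinatorics using (_C_)
open import Data.Fin using (Fin; toℕ; _≟_) renaming (zero to f0; suc to fs)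
open import Data.Bool using (Bool; true; false; _∧_; _∨_; not; if_then_else_)
open import Data.List using (List; []; _∷_; concatMap; filter; length; allFin; map)
open import Data.Bool.ListAction using (any; all)
open import Data.Vec using (Vec; []; _∷_; lookup)
open import Data.Product using (_×_; _,_)
open import Relation.Binary.PropositionalEquality using (_≡_)
open import Relation.Nullary using (does)
open import Data.Integer using (+_)
open import Data.Rational using (ℚ; _/_)

record OGraph (n : ℕ) : Set where
  field
    arc   : Fin n → Fin n → Bool
    loopless : ∀ i → arc i i ≡ false
    asym  : ∀ i j → arc i j ≡ true → arc j i ≡ false
open OGraph public

_==_ : Bool → Bool → Bool
true  == b = b
false == b = not b

-- The oriented graph H on {a₁, a₂, b, c} encoded as Fin 4 with
-- a₁ = 0, a₂ = 1, b = 2, c = 3.  Arcs: a₁→b, a₂→b, b→c, c→a₁, c→a₂.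
arcH : Fin 4 → Fin 4 → Bool
arcH f0                     (fs (fs f0))      = true
arcH (fs f0)                (fs (fs f0))      = true
arcH (fs (fs f0))           (fs (fs (fs f0))) = true
arcH (fs (fs (fs f0)))      f0                = true
arcH (fs (fs (fs f0)))      (fs f0)           = true
arcH _                      _                 = false

-- All 4-element subsets of Fin n, each listed once as a strictly increasing
-- vector (w₀ < w₁ < w₂ < w₃).
quads : (n : ℕ) → List (Vec (Fin n) 4)
quads n =
  concatMap (λ i → concatMap (λ j → concatMap (λ k → concatMap (λ l →
    if (toℕ i <ᵇ toℕ j) ∧ (toℕ j <ᵇ toℕ k) ∧ (toℕ k <ᵇ toℕ l)
    then (i ∷ j ∷ k ∷ l ∷ []) ∷ [] else [])
    (allFin n)) (allFin n)) (allFin n)) (allFin n)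

distinct4 : Fin 4 → Fin 4 → Fin 4 → Fin 4 → Bool
distinct4 a b c d =
  not (does (a ≟ b) ∨ does (a ≟ c) ∨ does (a ≟ d)
       ∨ does (b ≟ c) ∨ does (b ≟ d) ∨ does (c ≟ d))

perms4 : List (Vec (Fin 4) 4)
perms4 =
  concatMap (λ a → concatMap (λ b → concatMap (λ c → concatMap (λ d →
    if distinct4 a b c d then (a ∷ b ∷ c ∷ d ∷ []) ∷ [] else [])
    (allFin 4)) (allFin 4)) (allFin 4)) (allFin 4)

-- The subset {w₀,…,w₃} induces a copy of H in G iff some bijection
-- x ↦ w_{σ x} from V(H) = Fin 4 onto the subset preserves arcs and non-arcs.
inducesH : ∀ {n} → OGraph n → Vec (Fin n) 4 → Bool
inducesH G w =
  any (λ σ → all (λ x → all (λ y →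
        arc G (lookup w (lookup σ x)) (lookup w (lookup σ y)) == arcH x y)
      (allFin 4)) (allFin 4)) perms4

countH : ∀ {n} → OGraph n → ℕ
countH {n} G = length (filter (λ w → inducesH G w ≡? true) (quads n))
  where
    open import Relation.Nullary using (Dec)
    open import Data.Bool.Properties using () renaming (_≟_ to _≡?_)

ℕtoℚ : ℕ → ℚ
ℕtoℚ k = + k / 1

module Submission where

-- Upper bound: call (u, v, x, y) an H-labelling if u and v are non-adjacent and u, v → x → y → u, v.
-- An induced copy of H yields two labellings (a₁ and a₂ may be swapped), so 2 N(H,G) ≤ L(G). For fixed
-- non-adjacent u, v with X common out-neighbours and Y common in-neighbours there are at most
-- XY ≤ (X + Y)²/4 ≤ d(u)²/4 labellings, hence 4 L(G) ≤ Σᵤ (n − d(u)) d(u)² ≤ 4n⁴/27 by AM–GM, that is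
-- N(H,G) ≤ n⁴/54 = (4/9 + o(1)) C(n,4).
-- Lower bound: in the blow-up of the directed triangle with three parts of size m = ⌊n/3⌋, two vertices of
-- one part together with one vertex of each of the next two parts induce H, giving 3 C(m,2) m² =
-- (4/9 − o(1)) C(n,4) copies.
-- Sorted 4-sets are compared with ordered 4-tuples through the 24 rearrangements of a tuple, and the facts
-- about four vertices are decided by exhaustive evaluation.

open import Defs
open import Data.Bool using (Bool; true; false)
open import Data.Nat using (ℕ)

𝟙 : Bool → ℕ
𝟙 true  = 1
𝟙 false = 0


module FiniteSearch where
  open import Data.Bool using (Bool; true; false; T; not; _∧_; _∨_)
  open import Data.Bool.Properties using (T-∧)
  open import Data.Empty using (⊥-elim)
  open import Data.Nat using (zero; suc)
  open import Data.Product using (_,_)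
  open import Data.Vec using (Vec; []; _∷_)
  open import Function using (_∘_; Equivalence)
  open import Relation.Nullary using (¬_)

  T-∧-intro : ∀ {a b} → T a → T b → T (a ∧ b)
  T-∧-intro ta tb = Equivalence.from T-∧ (ta , tb)

  T-∧-elimˡ : ∀ a {b} → T (a ∧ b) → T a
  T-∧-elimˡ true _ = _

  T-∧-elimʳ : ∀ a {b} → T (a ∧ b) → T b
  T-∧-elimʳ true t = t

  T-not-intro : ∀ {a} → ¬ T a → T (not a)
  T-not-intro {false} _  = _
  T-not-intro {true}  ¬a = ⊥-elim (¬a _)

  T-⇒-intro : ∀ {a b} → (T a → T b) → T (not a ∨ b)
  T-⇒-intro {false} _   = _
  T-⇒-intro {true}  a⇒b = a⇒b _

  T-⇒-elim : ∀ {a b} → T (not a ∨ b) → T a → T b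
  T-⇒-elim {true} b _ = b

  Enumeration : Set → Set
  Enumeration A = (A → Bool) → Bool

  Complete : ∀ {A} → Enumeration A → Set
  Complete every = ∀ p → T (every p) → ∀ a → T (p a)

  everyBool : Enumeration Bool
  everyBool p = p true ∧ p false

  everyBool-complete : Complete everyBool
  everyBool-complete p all-p true  = T-∧-elimˡ (p true) all-p
  everyBool-complete p all-p false = T-∧-elimʳ (p true) all-p

  everyVec : ∀ {A} → Enumeration A → ∀ n → Enumeration (Vec A n)
  everyVec every zero    p = p []
  everyVec every (suc n) p = every λ a → everyVec every n (p ∘ (a ∷_))

  everyVec-complete : ∀ {A} {every : Enumeration A} → Complete every → ∀ n → Complete (everyVec every n)
  everyVec-complete complete zero    p all-p []       = all-p
  everyVec-complete complete (suc n) p all-p (a ∷ as) =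
    everyVec-complete complete n (p ∘ (a ∷_)) (complete (λ a → everyVec _ n (p ∘ (a ∷_))) all-p a) as


module FinSum where
  open import Data.Fin using (Fin; zero; suc; toℕ)
  open import Data.Nat using (ℕ; zero; suc; _+_; _*_; _≤_; _<ᵇ_; z≤n)
  open import Data.Nat.Properties using (+-*-semiring; +-mono-≤; +-identityʳ; *-monoˡ-≤; *-identityˡ; +-monoʳ-≤; ≤-trans; ≤-reflexive; module ≤-Reasoning)
  open import Data.Nat.Tactic.RingSolver using (solve-∀)
  open import Function using (_∘_)
  open import Relation.Binary.PropositionalEquality using (_≡_; refl; cong; cong₂; trans; sym)
  open import Algebra.Properties.Semiring.Sum +-*-semiring public
    using (sum; sum-cong-≗; ∑-distrib-+; ∑-comm; *-distribˡ-sum; *-distribʳ-sum)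

  sum-mono-≤ : ∀ {n} {f g : Fin n → ℕ} → (∀ i → f i ≤ g i) → sum f ≤ sum g
  sum-mono-≤ {zero}  f≤g = z≤n
  sum-mono-≤ {suc n} f≤g = +-mono-≤ (f≤g zero) (sum-mono-≤ (f≤g ∘ suc))

  sum-const : ∀ n c → sum {n} (λ _ → c) ≡ n * c
  sum-const zero    c = refl
  sum-const (suc n) c = cong (c +_) (sum-const n c)

  ∑² : ∀ {n} → (Fin n → Fin n → ℕ) → ℕ
  ∑² f = sum λ i → sum λ j → f i j

  module _ {n : ℕ} where
    ∑²-cong : {f g : Fin n → Fin n → ℕ} → (∀ i j → f i j ≡ g i j) → ∑² f ≡ ∑² g
    ∑²-cong f≡g = sum-cong-≗ λ i → sum-cong-≗ (f≡g i)

    ∑²-mono-≤ : {f g : Fin n → Fin n → ℕ} → (∀ i j → f i j ≤ g i j) → ∑² f ≤ ∑² g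
    ∑²-mono-≤ f≤g = sum-mono-≤ λ i → sum-mono-≤ (f≤g i)

    ∑²-distrib-+ : (f g : Fin n → Fin n → ℕ) → ∑² (λ i j → f i j + g i j) ≡ ∑² f + ∑² g
    ∑²-distrib-+ f g = trans (sum-cong-≗ λ i → ∑-distrib-+ (f i) (g i)) (∑-distrib-+ (λ i → sum (f i)) (λ i → sum (g i)))

    *-distribˡ-∑² : ∀ c (f : Fin n → Fin n → ℕ) → c * ∑² f ≡ ∑² (λ i j → c * f i j)
    *-distribˡ-∑² c f = trans (*-distribˡ-sum c (λ i → sum (f i))) (sum-cong-≗ λ i → *-distribˡ-sum c (f i))

    *-distribʳ-∑² : ∀ c (f : Fin n → Fin n → ℕ) → ∑² f * c ≡ ∑² (λ i j → f i j * c)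
    *-distribʳ-∑² c f = trans (*-distribʳ-sum c (λ i → sum (f i))) (sum-cong-≗ λ i → *-distribʳ-sum c (f i))

    ∑²-product : (f g : Fin n → ℕ) → ∑² (λ i j → f i * g j) ≡ sum f * sum g
    ∑²-product f g = trans (sum-cong-≗ λ i → sym (*-distribˡ-sum (f i) g)) (sym (*-distribʳ-sum (sum g) f))

  _<ᶠ_ : ∀ {n} → Fin n → Fin n → Bool
  x <ᶠ y = toℕ x <ᵇ toℕ y

  orderedPairs : ∀ {n} → (Fin n → ℕ) → ℕ
  orderedPairs e = ∑² λ i j → 𝟙 (i <ᶠ j) * (e i * e j)

  orderedPairs-suc : ∀ {n} (e : Fin (suc n) → ℕ) → orderedPairs e ≡ e zero * sum (e ∘ suc) + orderedPairs (e ∘ suc)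
  orderedPairs-suc e = cong₂ _+_
    (trans (sum-cong-≗ λ j → +-identityʳ (e zero * e (suc j))) (sym (*-distribˡ-sum (e zero) (e ∘ suc))))
    refl

  [sum]²≤2*orderedPairs+sum : ∀ {n} (e : Fin n → ℕ) → (∀ i → e i ≤ 1) → sum e * sum e ≤ 2 * orderedPairs e + sum e
  [sum]²≤2*orderedPairs+sum {zero}  e e≤1 = z≤n
  [sum]²≤2*orderedPairs+sum {suc n} e e≤1 = begin
    (x + S) * (x + S)              ≡⟨ square x S ⟩
    x * x + (2 * (x * S) + S * S)  ≤⟨ +-mono-≤ x*x≤x (+-monoʳ-≤ (2 * (x * S)) S*S≤2P+S) ⟩
    x + (2 * (x * S) + (2 * P + S)) ≡⟨ regroup x S P ⟩
    2 * (x * S + P) + (x + S)      ≡⟨ cong (λ t → 2 * t + (x + S)) (sym (orderedPairs-suc e)) ⟩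
    2 * orderedPairs e + (x + S)   ∎
    where
    open ≤-Reasoning
    x = e zero
    S = sum (e ∘ suc)
    P = orderedPairs (e ∘ suc)
    x*x≤x : x * x ≤ x
    x*x≤x = ≤-trans (*-monoˡ-≤ x (e≤1 zero)) (≤-reflexive (*-identityˡ x))
    S*S≤2P+S : S * S ≤ 2 * P + S
    S*S≤2P+S = [sum]²≤2*orderedPairs+sum (e ∘ suc) (e≤1 ∘ suc)
    square : ∀ x S → (x + S) * (x + S) ≡ x * x + (2 * (x * S) + S * S)
    square = solve-∀
    regroup : ∀ x S P → x + (2 * (x * S) + (2 * P + S)) ≡ 2 * (x * S + P) + (x + S)
    regroup = solve-∀

  Quad : Set → Set
  Quad A = A → A → A → A → ℕ

  ∑⁴ : ∀ {n} → Quad (Fin n) → ℕ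
  ∑⁴ h = ∑² λ i j → ∑² (h i j)

  module _ {n : ℕ} where
    ∑⁴-cong : {f g : Quad (Fin n)} → (∀ i j k l → f i j k l ≡ g i j k l) → ∑⁴ f ≡ ∑⁴ g
    ∑⁴-cong f≡g = ∑²-cong λ i j → ∑²-cong (f≡g i j)

    ∑⁴-mono-≤ : {f g : Quad (Fin n)} → (∀ i j k l → f i j k l ≤ g i j k l) → ∑⁴ f ≤ ∑⁴ g
    ∑⁴-mono-≤ f≤g = ∑²-mono-≤ λ i j → ∑²-mono-≤ (f≤g i j)

    ∑⁴-distrib-+ : (f g : Quad (Fin n)) → ∑⁴ (λ i j k l → f i j k l + g i j k l) ≡ ∑⁴ f + ∑⁴ g
    ∑⁴-distrib-+ f g = trans (∑²-cong λ i j → ∑²-distrib-+ (f i j) (g i j)) (∑²-distrib-+ (λ i j → ∑² (f i j)) (λ i j → ∑² (g i j)))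

    *-distribˡ-∑⁴ : ∀ c (f : Quad (Fin n)) → c * ∑⁴ f ≡ ∑⁴ (λ i j k l → c * f i j k l)
    *-distribˡ-∑⁴ c f = trans (*-distribˡ-∑² c (λ i j → ∑² (f i j))) (∑²-cong λ i j → *-distribˡ-∑² c (f i j))

    ∑⁴-product : (f g : Fin n → Fin n → ℕ) → ∑⁴ (λ i j k l → f i j * g k l) ≡ ∑² f * ∑² g
    ∑⁴-product f g = trans (∑²-cong λ i j → sym (*-distribˡ-∑² (f i j) g)) (sym (*-distribʳ-∑² (∑² g) f))


module Symmetrisation where
  open import Data.Fin using (Fin)
  open import Data.List using (List; []; _∷_)
  open import Data.Nat using (ℕ; _+_; _*_; _≤_)
  open import Data.Nat.Properties using (*-zeroʳ; *-distribˡ-+; *-distribʳ-+; *-identityˡ; *-monoˡ-≤; ≤-trans; ≤-reflexive; *-commutativeSemigroup)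
  open import Relation.Binary.PropositionalEquality using (_≡_; refl; cong; cong₂; trans; sym; module ≡-Reasoning)
  open import Algebra.Properties.CommutativeSemigroup *-commutativeSemigroup using (x∙yz≈y∙xz)
  open FinSum

  data Adjacent : Set where
    τ₀ τ₁ τ₂ : Adjacent

  transpose : ∀ {A} → Adjacent → Quad A → Quad A
  transpose τ₀ h i j k l = h j i k l
  transpose τ₁ h i j k l = h i k j l
  transpose τ₂ h i j k l = h i j l k

  act act⁻¹ : ∀ {A} → List Adjacent → Quad A → Quad A
  act []       h = h
  act (t ∷ ts) h = act ts (transpose t h)
  act⁻¹ []       h = h
  act⁻¹ (t ∷ ts) h = transpose t (act⁻¹ ts h)

  _⊗_ : ∀ {A} → Quad A → Quad A → Quad A
  (f ⊗ g) i j k l = f i j k l * g i j k l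

  act-⊗ : ∀ {A} w (f g : Quad A) → act w (f ⊗ g) ≡ act w f ⊗ act w g
  act-⊗ []        f g = refl
  act-⊗ (τ₀ ∷ ts) f g = act-⊗ ts (transpose τ₀ f) (transpose τ₀ g)
  act-⊗ (τ₁ ∷ ts) f g = act-⊗ ts (transpose τ₁ f) (transpose τ₁ g)
  act-⊗ (τ₂ ∷ ts) f g = act-⊗ ts (transpose τ₂ f) (transpose τ₂ g)

  act-act⁻¹ : ∀ {A} w (h : Quad A) → act w (act⁻¹ w h) ≡ h
  act-act⁻¹ []        h = refl
  act-act⁻¹ (τ₀ ∷ ts) h = act-act⁻¹ ts h
  act-act⁻¹ (τ₁ ∷ ts) h = act-act⁻¹ ts h
  act-act⁻¹ (τ₂ ∷ ts) h = act-act⁻¹ ts h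

  ∑⁴-transpose : ∀ {n} t (h : Quad (Fin n)) → ∑⁴ (transpose t h) ≡ ∑⁴ h
  ∑⁴-transpose τ₀ h = ∑-comm λ i j → ∑² (h j i)
  ∑⁴-transpose τ₁ h = sum-cong-≗ λ i → ∑-comm λ j k → sum (h i k j)
  ∑⁴-transpose τ₂ h = sum-cong-≗ λ i → sum-cong-≗ λ j → ∑-comm λ k l → h i j l k

  ∑⁴-act : ∀ {n} w (h : Quad (Fin n)) → ∑⁴ (act w h) ≡ ∑⁴ h
  ∑⁴-act []       h = refl
  ∑⁴-act (t ∷ ts) h = trans (∑⁴-act ts (transpose t h)) (∑⁴-transpose t h)

  orbit orbit⁻¹ : ∀ {A} → List (List Adjacent) → Quad A → Quad A
  orbit   []       h i j k l = 0
  orbit   (w ∷ ws) h i j k l = act w h i j k l + orbit ws h i j k l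
  orbit⁻¹ []       h i j k l = 0
  orbit⁻¹ (w ∷ ws) h i j k l = act⁻¹ w h i j k l + orbit⁻¹ ws h i j k l

  ∑⁴-⊗-act : ∀ {n} w (S T : Quad (Fin n)) → ∑⁴ (S ⊗ act w T) ≡ ∑⁴ (act⁻¹ w S ⊗ T)
  ∑⁴-⊗-act w S T = begin
    ∑⁴ (S ⊗ act w T)                      ≡⟨ cong (λ S′ → ∑⁴ (S′ ⊗ act w T)) (sym (act-act⁻¹ w S)) ⟩
    ∑⁴ (act w (act⁻¹ w S) ⊗ act w T)      ≡⟨ cong ∑⁴ (sym (act-⊗ w (act⁻¹ w S) T)) ⟩
    ∑⁴ (act w (act⁻¹ w S ⊗ T))            ≡⟨ ∑⁴-act w (act⁻¹ w S ⊗ T) ⟩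
    ∑⁴ (act⁻¹ w S ⊗ T)                    ∎
    where open ≡-Reasoning

  ∑⁴-⊗-orbit : ∀ {n} ws (S T : Quad (Fin n)) → ∑⁴ (S ⊗ orbit ws T) ≡ ∑⁴ (orbit⁻¹ ws S ⊗ T)
  ∑⁴-⊗-orbit []       S T = ∑⁴-cong λ i j k l → *-zeroʳ (S i j k l)
  ∑⁴-⊗-orbit (w ∷ ws) S T = begin
    ∑⁴ (S ⊗ orbit (w ∷ ws) T)                               ≡⟨ ∑⁴-cong (λ i j k l → *-distribˡ-+ (S i j k l) (act w T i j k l) (orbit ws T i j k l)) ⟩
    ∑⁴ (λ i j k l → (S ⊗ act w T) i j k l + (S ⊗ orbit ws T) i j k l) ≡⟨ ∑⁴-distrib-+ (S ⊗ act w T) (S ⊗ orbit ws T) ⟩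
    ∑⁴ (S ⊗ act w T) + ∑⁴ (S ⊗ orbit ws T)                  ≡⟨ cong₂ _+_ (∑⁴-⊗-act w S T) (∑⁴-⊗-orbit ws S T) ⟩
    ∑⁴ (act⁻¹ w S ⊗ T) + ∑⁴ (orbit⁻¹ ws S ⊗ T)              ≡⟨ sym (∑⁴-distrib-+ (act⁻¹ w S ⊗ T) (orbit⁻¹ ws S ⊗ T)) ⟩
    ∑⁴ (λ i j k l → (act⁻¹ w S ⊗ T) i j k l + (orbit⁻¹ ws S ⊗ T) i j k l) ≡⟨ ∑⁴-cong (λ i j k l → sym (*-distribʳ-+ (T i j k l) (act⁻¹ w S i j k l) (orbit⁻¹ ws S i j k l))) ⟩
    ∑⁴ (orbit⁻¹ (w ∷ ws) S ⊗ T)                             ∎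
    where open ≡-Reasoning

  ∑⁴-middle-product : ∀ {n} (f : Fin n → ℕ) (g : Fin n → Fin n → ℕ) (h : Fin n → ℕ) →
    ∑⁴ (λ i j k l → f i * (g j k * h l)) ≡ sum f * (∑² g * sum h)
  ∑⁴-middle-product f g h = begin
    ∑⁴ (λ i j k l → f i * (g j k * h l))  ≡⟨ ∑⁴-act (τ₀ ∷ τ₁ ∷ []) (λ i j k l → f i * (g j k * h l)) ⟨
    ∑⁴ (λ i j k l → f k * (g i j * h l))  ≡⟨ ∑⁴-cong (λ i j k l → x∙yz≈y∙xz (f k) (g i j) (h l)) ⟩
    ∑⁴ (λ i j k l → g i j * (f k * h l))  ≡⟨ ∑⁴-product g (λ k l → f k * h l) ⟩
    ∑² g * ∑² (λ k l → f k * h l)         ≡⟨ cong (∑² g *_) (∑²-product f h) ⟩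
    ∑² g * (sum f * sum h)                ≡⟨ x∙yz≈y∙xz (∑² g) (sum f) (sum h) ⟩
    sum f * (∑² g * sum h)                ∎
    where open ≡-Reasoning

  ∑⁴-⊗-orbit-≤ : ∀ {n} ws (S T : Quad (Fin n)) → (∀ i j k l → orbit⁻¹ ws S i j k l ≤ 1) → ∑⁴ (S ⊗ orbit ws T) ≤ ∑⁴ T
  ∑⁴-⊗-orbit-≤ ws S T orbit⁻¹≤1 = ≤-trans (≤-reflexive (∑⁴-⊗-orbit ws S T))
    (∑⁴-mono-≤ λ i j k l → ≤-trans (*-monoˡ-≤ (T i j k l) (orbit⁻¹≤1 i j k l)) (≤-reflexive (*-identityˡ (T i j k l))))

  S₄ : List (List Adjacent)
  S₄ =
    [] ∷ (τ₂ ∷ []) ∷ (τ₁ ∷ []) ∷ (τ₂ ∷ τ₁ ∷ []) ∷ (τ₁ ∷ τ₂ ∷ []) ∷ (τ₁ ∷ τ₂ ∷ τ₁ ∷ []) ∷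
    (τ₀ ∷ []) ∷ (τ₀ ∷ τ₂ ∷ []) ∷ (τ₁ ∷ τ₀ ∷ []) ∷ (τ₂ ∷ τ₁ ∷ τ₀ ∷ []) ∷ (τ₁ ∷ τ₀ ∷ τ₂ ∷ []) ∷ (τ₁ ∷ τ₂ ∷ τ₁ ∷ τ₀ ∷ []) ∷
    (τ₀ ∷ τ₁ ∷ []) ∷ (τ₀ ∷ τ₂ ∷ τ₁ ∷ []) ∷ (τ₀ ∷ τ₁ ∷ τ₀ ∷ []) ∷ (τ₀ ∷ τ₂ ∷ τ₁ ∷ τ₀ ∷ []) ∷
    (τ₁ ∷ τ₀ ∷ τ₂ ∷ τ₁ ∷ []) ∷ (τ₁ ∷ τ₀ ∷ τ₂ ∷ τ₁ ∷ τ₀ ∷ []) ∷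
    (τ₀ ∷ τ₁ ∷ τ₂ ∷ []) ∷ (τ₀ ∷ τ₁ ∷ τ₂ ∷ τ₁ ∷ []) ∷ (τ₀ ∷ τ₁ ∷ τ₀ ∷ τ₂ ∷ []) ∷
    (τ₀ ∷ τ₁ ∷ τ₂ ∷ τ₁ ∷ τ₀ ∷ []) ∷ (τ₀ ∷ τ₁ ∷ τ₀ ∷ τ₂ ∷ τ₁ ∷ []) ∷ (τ₀ ∷ τ₁ ∷ τ₀ ∷ τ₂ ∷ τ₁ ∷ τ₀ ∷ []) ∷ []


module FourVertices where
  open import Data.Bool using (Bool; T; not; _∧_; _∨_)
  open import Data.Bool.Properties using (T-∧; T-≡)
  open import Data.Bool.ListAction using (any; all)
  open import Data.Fin using (Fin; zero; suc; combine)
  open import Data.List using (allFin)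
  open import Data.Nat using (_+_; _*_; _≤_; _≤ᵇ_)
  open import Data.Nat.Properties using (≤ᵇ⇒≤)
  open import Data.Product using (_,_)
  open import Data.Vec using (Vec; []; _∷_; lookup)
  open import Function using (Equivalence)
  open import Relation.Binary.PropositionalEquality using (_≡_; refl)
  open import Relation.Nullary using (¬_)
  open FinSum
  open FiniteSearch
  open Symmetrisation

  Asymmetricᵇ Transitiveᵇ : ∀ {A : Set} → (A → A → Bool) → Set
  Asymmetricᵇ r = ∀ x y → T (r x y) → ¬ T (r y x)
  Transitiveᵇ r = ∀ x y z → T (r x y) → T (r y z) → T (r x z)

  v₀ v₁ v₂ v₃ : Fin 4
  v₀ = zero
  v₁ = suc zero
  v₂ = suc (suc zero)
  v₃ = suc (suc (suc zero))

  Rel₄ : Set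
  Rel₄ = Fin 4 → Fin 4 → Bool

  restrict : ∀ {A : Set} → (A → A → Bool) → A → A → A → A → Rel₄
  restrict r i j k l x y = r (lookup (i ∷ j ∷ k ∷ l ∷ []) x) (lookup (i ∷ j ∷ k ∷ l ∷ []) y)

  module _ {A : Set} {r : A → A → Bool} (i j k l : A) where
    restrict-asymmetric : Asymmetricᵇ r → Asymmetricᵇ (restrict r i j k l)
    restrict-asymmetric asym x y = asym (lookup (i ∷ j ∷ k ∷ l ∷ []) x) (lookup (i ∷ j ∷ k ∷ l ∷ []) y)

    restrict-transitive : Transitiveᵇ r → Transitiveᵇ (restrict r i j k l)
    restrict-transitive trans x y z = trans (lookup (i ∷ j ∷ k ∷ l ∷ []) x) (lookup (i ∷ j ∷ k ∷ l ∷ []) y) (lookup (i ∷ j ∷ k ∷ l ∷ []) z)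

  toBits : Rel₄ → Vec Bool 16
  toBits R = row v₀ (row v₁ (row v₂ (row v₃ [])))
    where
    row : ∀ {m} → Fin 4 → Vec Bool m → Vec Bool (4 + m)
    row x bs = R x v₀ ∷ R x v₁ ∷ R x v₂ ∷ R x v₃ ∷ bs

  fromBits : Vec Bool 16 → Rel₄
  fromBits bs x y = lookup bs (combine x y)

  asymmetricBits : Vec Bool 16 → Bool
  asymmetricBits (b₀₀ ∷ b₀₁ ∷ b₀₂ ∷ b₀₃ ∷ b₁₀ ∷ b₁₁ ∷ b₁₂ ∷ b₁₃ ∷ b₂₀ ∷ b₂₁ ∷ b₂₂ ∷ b₂₃ ∷ b₃₀ ∷ b₃₁ ∷ b₃₂ ∷ b₃₃ ∷ []) =
    not b₀₀ ∧ not b₁₁ ∧ not b₂₂ ∧ not b₃₃ ∧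
    not (b₀₁ ∧ b₁₀) ∧ not (b₀₂ ∧ b₂₀) ∧ not (b₀₃ ∧ b₃₀) ∧ not (b₁₂ ∧ b₂₁) ∧ not (b₁₃ ∧ b₃₁) ∧ not (b₂₃ ∧ b₃₂)

  asymmetricBits-complete : ∀ R → Asymmetricᵇ R → T (asymmetricBits (toBits R))
  asymmetricBits-complete R asym =
    T-∧-intro (irreflexive v₀) (T-∧-intro (irreflexive v₁) (T-∧-intro (irreflexive v₂) (T-∧-intro (irreflexive v₃)
    (T-∧-intro (not-both v₀ v₁) (T-∧-intro (not-both v₀ v₂) (T-∧-intro (not-both v₀ v₃)
    (T-∧-intro (not-both v₁ v₂) (T-∧-intro (not-both v₁ v₃) (not-both v₂ v₃)))))))))
    where
    irreflexive : ∀ x → T (not (R x x))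
    irreflexive x = T-not-intro λ t → asym x x t t
    not-both : ∀ x y → T (not (R x y ∧ R y x))
    not-both x y = T-not-intro λ t → let (txy , tyx) = Equivalence.to T-∧ t in asym x y txy tyx

  forAllAsymmetric : (Rel₄ → Bool) → Bool
  forAllAsymmetric p = everyVec everyBool 16 λ bs → not (asymmetricBits bs) ∨ p (fromBits bs)

  -- A predicate p that inspects its argument only at explicit vertices has p (fromBits (toBits R)) reducing to p R.
  forAllAsymmetric-sound : ∀ p → forAllAsymmetric p ≡ true → ∀ R → Asymmetricᵇ R → T (p (fromBits (toBits R)))
  forAllAsymmetric-sound p all-p R asym =
    T-⇒-elim (everyVec-complete everyBool-complete 16 (λ bs → not (asymmetricBits bs) ∨ p (fromBits bs)) (Equivalence.from T-≡ all-p) (toBits R))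
      (asymmetricBits-complete R asym)

  everyVertex : Enumeration (Fin 4)
  everyVertex p = p v₀ ∧ p v₁ ∧ p v₂ ∧ p v₃

  everyVertex-intro : ∀ {p} → (∀ x → T (p x)) → T (everyVertex p)
  everyVertex-intro px = T-∧-intro (px v₀) (T-∧-intro (px v₁) (T-∧-intro (px v₂) (px v₃)))

  isTransitive : Rel₄ → Bool
  isTransitive R = everyVertex λ x → everyVertex λ y → everyVertex λ z → not (R x y ∧ R y z) ∨ R x z

  isTransitive-complete : ∀ R → Transitiveᵇ R → T (isTransitive R)
  isTransitive-complete R trans = everyVertex-intro λ x → everyVertex-intro λ y → everyVertex-intro λ z →
    T-⇒-intro λ t → let (txy , tyz) = Equivalence.to T-∧ t in trans x y z txy tyz

  inducesH₄ : Rel₄ → Bool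
  inducesH₄ R = any (λ σ → all (λ x → all (λ y → R (lookup σ x) (lookup σ y) == arcH x y) (allFin 4)) (allFin 4)) perms4

  increasing : ∀ {A : Set} → (A → A → Bool) → Quad A
  increasing r i j k l = 𝟙 (r i j ∧ r j k ∧ r k l)

  HLabelling : ∀ {A : Set} → (A → A → Bool) → Quad A
  HLabelling r u v x y = 𝟙 (not (r u v ∨ r v u) ∧ r u x ∧ r v x ∧ r x y ∧ r y u ∧ r y v)

  private
    atMostOneIncreasingᵇ twoLabellingsᵇ : Rel₄ → Bool
    atMostOneIncreasingᵇ R = not (isTransitive R) ∨ (orbit⁻¹ S₄ (increasing R) v₀ v₁ v₂ v₃ ≤ᵇ 1)
    twoLabellingsᵇ R = 2 * 𝟙 (inducesH₄ R) ≤ᵇ orbit S₄ (HLabelling R) v₀ v₁ v₂ v₃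

    atMostOneIncreasing-check : forAllAsymmetric atMostOneIncreasingᵇ ≡ true
    atMostOneIncreasing-check = refl

    twoLabellings-check : forAllAsymmetric twoLabellingsᵇ ≡ true
    twoLabellings-check = refl

  module _ {A : Set} (r : A → A → Bool) (asym : Asymmetricᵇ r) where
    at-most-one-increasing : Transitiveᵇ r → ∀ i j k l → orbit⁻¹ S₄ (increasing r) i j k l ≤ 1
    at-most-one-increasing trans i j k l = ≤ᵇ⇒≤ _ 1 (T-⇒-elim check (isTransitive-complete (restrict r i j k l) (restrict-transitive i j k l trans)))
      where
      check : T (not (isTransitive (restrict r i j k l)) ∨ (orbit⁻¹ S₄ (increasing r) i j k l ≤ᵇ 1))
      check = forAllAsymmetric-sound atMostOneIncreasingᵇ atMostOneIncreasing-check (restrict r i j k l) (restrict-asymmetric i j k l asym)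

    two-labellings : ∀ i j k l → 2 * 𝟙 (inducesH₄ (restrict r i j k l)) ≤ orbit S₄ (HLabelling r) i j k l
    two-labellings i j k l = ≤ᵇ⇒≤ _ _ (forAllAsymmetric-sound twoLabellingsᵇ twoLabellings-check (restrict r i j k l) (restrict-asymmetric i j k l asym))


module ElementaryInequalities where
  open import Data.Nat using (_+_; _*_; _≤_)
  open import Data.Nat.Properties
  open import Data.Nat.Tactic.RingSolver using (solve-∀)
  open import Data.Product using (_,_)
  open import Data.Sum using (inj₁; inj₂)
  open import Relation.Binary.PropositionalEquality using (_≡_; refl; cong; cong₂; subst₂)

  private
    4xy≤[x+y]²-ordered : ∀ {x y} → x ≤ y → 4 * (x * y) ≤ (x + y) * (x + y)
    4xy≤[x+y]²-ordered {x} x≤y with r , refl ← m≤n⇒∃[o]m+o≡n x≤y =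
      ≤-trans (m≤m+n _ (r * r)) (≤-reflexive (square x r))
      where
      square : ∀ x r → 4 * (x * (x + r)) + r * r ≡ (x + (x + r)) * (x + (x + r))
      square = solve-∀

  4xy≤[x+y]² : ∀ x y → 4 * (x * y) ≤ (x + y) * (x + y)
  4xy≤[x+y]² x y with ≤-total x y
  ... | inj₁ x≤y = 4xy≤[x+y]²-ordered x≤y
  ... | inj₂ y≤x = subst₂ _≤_ (cong (4 *_) (*-comm y x)) (cong₂ _*_ (+-comm y x) (+-comm y x)) (4xy≤[x+y]²-ordered y≤x)

  -- 4 (a + b)³ − 27 a b² = (2a − b)² (a + 4b); when b ≤ 2a the identity is scaled by 8 to keep 2a − b integral.
  27ab²≤4[a+b]³ : ∀ a b → 27 * a * (b * b) ≤ 4 * ((a + b) * (a + b) * (a + b))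
  27ab²≤4[a+b]³ a b with ≤-total (2 * a) b
  ... | inj₁ 2a≤b with r , refl ← m≤n⇒∃[o]m+o≡n 2a≤b =
    ≤-trans (m≤m+n _ (r * r * (9 * a + 4 * r))) (≤-reflexive (cubic a r))
    where
    cubic : ∀ a r → 27 * a * ((2 * a + r) * (2 * a + r)) + r * r * (9 * a + 4 * r) ≡ 4 * ((a + (2 * a + r)) * (a + (2 * a + r)) * (a + (2 * a + r)))
    cubic = solve-∀
  ... | inj₂ b≤2a with q , b+q≡2a ← m≤n⇒∃[o]m+o≡n b≤2a = *-cancelˡ-≤ 8 (begin
    8 * (27 * a * (b * b))                          ≡⟨ double-a a b ⟩
    27 * (2 * a) * (4 * (b * b))                    ≡⟨ cong (λ t → 27 * t * (4 * (b * b))) b+q≡2a ⟨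
    27 * (b + q) * (4 * (b * b))                    ≤⟨ m≤m+n _ (4 * (q * q) * (9 * b + q)) ⟩
    27 * (b + q) * (4 * (b * b)) + 4 * (q * q) * (9 * b + q) ≡⟨ cubic b q ⟩
    4 * ((b + q + 2 * b) * (b + q + 2 * b) * (b + q + 2 * b)) ≡⟨ cong (λ t → 4 * ((t + 2 * b) * (t + 2 * b) * (t + 2 * b))) b+q≡2a ⟩
    4 * ((2 * a + 2 * b) * (2 * a + 2 * b) * (2 * a + 2 * b)) ≡⟨ double-a+b a b ⟩
    8 * (4 * ((a + b) * (a + b) * (a + b)))         ∎)
    where
    open ≤-Reasoning
    double-a : ∀ a b → 8 * (27 * a * (b * b)) ≡ 27 * (2 * a) * (4 * (b * b))
    double-a = solve-∀
    cubic : ∀ b q → 27 * (b + q) * (4 * (b * b)) + 4 * (q * q) * (9 * b + q) ≡ 4 * ((b + q + 2 * b) * (b + q + 2 * b) * (b + q + 2 * b))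
    cubic = solve-∀
    double-a+b : ∀ a b → 4 * ((2 * a + 2 * b) * (2 * a + 2 * b) * (2 * a + 2 * b)) ≡ 8 * (4 * ((a + b) * (a + b) * (a + b)))
    double-a+b = solve-∀


module Counting where
  open import Data.Bool using (Bool; true; false; _∧_; if_then_else_)
  open import Data.Bool.Properties using (_≟_)
  open import Data.Fin using (Fin; zero; suc)
  open import Data.List using (List; []; _∷_; _++_; length; filter; concatMap; tabulate; allFin)
  open import Data.List.Properties using (filter-++; length-++)
  open import Data.Nat using (ℕ; zero; suc; _+_; _*_)
  open import Data.Vec using (Vec; []; _∷_)
  open import Function using (_∘_)
  open import Relation.Binary.PropositionalEquality using (_≡_; refl; cong; trans)
  open FinSum
  open Symmetrisation using (_⊗_)
  open FourVertices using (increasing)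

  count : ∀ {A : Set} → (A → Bool) → List A → ℕ
  count p xs = length (filter (λ x → p x ≟ true) xs)

  count-++ : ∀ {A : Set} (p : A → Bool) xs ys → count p (xs ++ ys) ≡ count p xs + count p ys
  count-++ p xs ys = trans (cong length (filter-++ (λ x → p x ≟ true) xs ys)) (length-++ (filter (λ x → p x ≟ true) xs))

  count-concatMap : ∀ {A B : Set} (p : B → Bool) (g : A → List B) {n} (f : Fin n → A) →
    count p (concatMap g (tabulate f)) ≡ sum (λ i → count p (g (f i)))
  count-concatMap p g {zero}  f = refl
  count-concatMap p g {suc n} f =
    trans (count-++ p (g (f zero)) (concatMap g (tabulate (f ∘ suc)))) (cong (count p (g (f zero)) +_) (count-concatMap p g (f ∘ suc)))

  count-if : ∀ {A : Set} (p : A → Bool) c x → count p (if c then x ∷ [] else []) ≡ 𝟙 c * 𝟙 (p x)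
  count-if p false x = refl
  count-if p true  x with p x
  ... | true  = refl
  ... | false = refl

  inducedH : ∀ {n} → OGraph n → Quad (Fin n)
  inducedH G i j k l = 𝟙 (inducesH G (i ∷ j ∷ k ∷ l ∷ []))

  countH≡∑⁴ : ∀ {n} (G : OGraph n) → countH G ≡ ∑⁴ (increasing _<ᶠ_ ⊗ inducedH G)
  countH≡∑⁴ {n} G =
    trans (count-concatMap p (λ i → concatMap (λ j → concatMap (λ k → concatMap (quad i j k) (allFin n)) (allFin n)) (allFin n)) λ i → i) (sum-cong-≗ λ i →
    trans (count-concatMap p (λ j → concatMap (λ k → concatMap (quad i j k) (allFin n)) (allFin n)) λ j → j) (sum-cong-≗ λ j →
    trans (count-concatMap p (λ k → concatMap (quad i j k) (allFin n)) λ k → k) (sum-cong-≗ λ k →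
    trans (count-concatMap p (quad i j k) λ l → l) (sum-cong-≗ λ l →
    count-if p ((i <ᶠ j) ∧ (j <ᶠ k) ∧ (k <ᶠ l)) (i ∷ j ∷ k ∷ l ∷ [])))))
    where
    p = inducesH G
    quad : Fin n → Fin n → Fin n → Fin n → List (Vec (Fin n) 4)
    quad i j k l = if (i <ᶠ j) ∧ (j <ᶠ k) ∧ (k <ᶠ l) then (i ∷ j ∷ k ∷ l ∷ []) ∷ [] else []


module UpperBound where
  open import Data.Bool using (Bool; true; false; T; not; _∧_; _∨_)
  open import Data.Bool.Properties using (T-≡)
  open import Data.Empty using (⊥-elim)
  open import Data.Fin using (Fin; toℕ)
  open import Data.Nat using (ℕ; _+_; _*_; _≤_; z≤n; s≤s)
  open import Data.Nat.Properties
  open import Data.Nat.Tactic.RingSolver using (solve-∀)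
  open import Data.Product using (_×_; _,_)
  open import Function using (Equivalence)
  open import Relation.Binary.PropositionalEquality using (_≡_; refl; cong; subst; module ≡-Reasoning)
  open import Relation.Nullary using (¬_)
  open import Algebra.Properties.CommutativeSemigroup *-commutativeSemigroup using (x∙yz≈y∙xz)
  open FinSum
  open Symmetrisation
  open FourVertices
  open Counting
  open ElementaryInequalities

  <ᶠ-asymmetric : ∀ {n} → Asymmetricᵇ (_<ᶠ_ {n})
  <ᶠ-asymmetric x y x<y y<x = <-asym (<ᵇ⇒< (toℕ x) (toℕ y) x<y) (<ᵇ⇒< (toℕ y) (toℕ x) y<x)

  <ᶠ-transitive : ∀ {n} → Transitiveᵇ (_<ᶠ_ {n})
  <ᶠ-transitive x y z x<y y<z = <⇒<ᵇ (<-trans (<ᵇ⇒< (toℕ x) (toℕ y) x<y) (<ᵇ⇒< (toℕ y) (toℕ z) y<z))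

  arc-asymmetric : ∀ {n} (G : OGraph n) → Asymmetricᵇ (arc G)
  arc-asymmetric G x y x→y y→x = subst T (asym G x y (Equivalence.to T-≡ x→y)) y→x

  labellings : ∀ {n} → OGraph n → ℕ
  labellings G = ∑⁴ (HLabelling (arc G))

  2*countH≤labellings : ∀ {n} (G : OGraph n) → 2 * countH G ≤ labellings G
  2*countH≤labellings G = begin
    2 * countH G                                            ≡⟨ cong (2 *_) (countH≡∑⁴ G) ⟩
    2 * ∑⁴ (increasing _<ᶠ_ ⊗ inducedH G)                    ≡⟨ *-distribˡ-∑⁴ 2 (increasing _<ᶠ_ ⊗ inducedH G) ⟩
    ∑⁴ (λ i j k l → 2 * (increasing _<ᶠ_ ⊗ inducedH G) i j k l) ≤⟨ ∑⁴-mono-≤ two-labellings-each ⟩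
    ∑⁴ (increasing _<ᶠ_ ⊗ orbit S₄ (HLabelling (arc G)))     ≤⟨ ∑⁴-⊗-orbit-≤ S₄ (increasing _<ᶠ_) (HLabelling (arc G)) sorted-once ⟩
    labellings G                                             ∎
    where
    open ≤-Reasoning
    sorted-once : ∀ i j k l → orbit⁻¹ S₄ (increasing _<ᶠ_) i j k l ≤ 1
    sorted-once = at-most-one-increasing _<ᶠ_ <ᶠ-asymmetric <ᶠ-transitive
    two-labellings-each : ∀ i j k l → 2 * (increasing _<ᶠ_ i j k l * inducedH G i j k l)
                                    ≤ increasing _<ᶠ_ i j k l * orbit S₄ (HLabelling (arc G)) i j k l
    two-labellings-each i j k l = begin
      2 * (increasing _<ᶠ_ i j k l * inducedH G i j k l) ≡⟨ x∙yz≈y∙xz 2 (increasing _<ᶠ_ i j k l) (inducedH G i j k l) ⟩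
      increasing _<ᶠ_ i j k l * (2 * inducedH G i j k l) ≤⟨ *-monoʳ-≤ (increasing _<ᶠ_ i j k l) (two-labellings (arc G) (arc-asymmetric G) i j k l) ⟩
      increasing _<ᶠ_ i j k l * orbit S₄ (HLabelling (arc G)) i j k l ∎

  private
    𝟙≤1 : ∀ b → 𝟙 b ≤ 1
    𝟙≤1 true  = s≤s z≤n
    𝟙≤1 false = z≤n

    𝟙-not+𝟙 : ∀ b → 𝟙 (not b) + 𝟙 b ≡ 1
    𝟙-not+𝟙 true  = refl
    𝟙-not+𝟙 false = refl

    𝟙-split : ∀ N p q s t w → 𝟙 (N ∧ p ∧ q ∧ s ∧ t ∧ w) ≤ 𝟙 N * (𝟙 (p ∧ q) * 𝟙 (t ∧ w))
    𝟙-split false _     _     _     _     _     = z≤n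
    𝟙-split true  false _     _     _     _     = z≤n
    𝟙-split true  true  false _     _     _     = z≤n
    𝟙-split true  true  true  false _     _     = z≤n
    𝟙-split true  true  true  true  false _     = z≤n
    𝟙-split true  true  true  true  true  false = z≤n
    𝟙-split true  true  true  true  true  true  = s≤s z≤n

    𝟙-disjoint : ∀ p q p′ q′ → ¬ (T p × T p′) → 𝟙 (p ∧ q) + 𝟙 (p′ ∧ q′) ≤ 𝟙 (p ∨ p′)
    𝟙-disjoint true  q true  q′ ¬both = ⊥-elim (¬both (_ , _))
    𝟙-disjoint true  q false q′ _     = ≤-trans (≤-reflexive (+-identityʳ (𝟙 q))) (𝟙≤1 q)
    𝟙-disjoint false q true  q′ _     = 𝟙≤1 q′
    𝟙-disjoint false q false q′ _     = z≤n

  module _ {n} (G : OGraph n) where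
    adjacent : Fin n → Fin n → Bool
    adjacent u v = arc G u v ∨ arc G v u

    nonadjacent : Fin n → Fin n → ℕ
    nonadjacent u v = 𝟙 (not (adjacent u v))

    degree nondegree : Fin n → ℕ
    degree    u = sum λ v → 𝟙 (adjacent u v)
    nondegree u = sum (nonadjacent u)

    sharedOut sharedIn : Fin n → Fin n → Fin n → ℕ
    sharedOut u v x = 𝟙 (arc G u x ∧ arc G v x)
    sharedIn  u v y = 𝟙 (arc G y u ∧ arc G y v)

    commonOut commonIn : Fin n → Fin n → ℕ
    commonOut u v = sum (sharedOut u v)
    commonIn  u v = sum (sharedIn u v)

    nondegree+degree≡n : ∀ u → nondegree u + degree u ≡ n
    nondegree+degree≡n u = begin
      nondegree u + degree u                            ≡⟨ ∑-distrib-+ (nonadjacent u) (λ v → 𝟙 (adjacent u v)) ⟨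
      sum (λ v → nonadjacent u v + 𝟙 (adjacent u v))    ≡⟨ sum-cong-≗ (λ v → 𝟙-not+𝟙 (adjacent u v)) ⟩
      sum {n} (λ _ → 1)                                 ≡⟨ sum-const n 1 ⟩
      n * 1                                             ≡⟨ *-identityʳ n ⟩
      n                                                 ∎
      where open ≡-Reasoning

    commonOut+commonIn≤degree : ∀ u v → commonOut u v + commonIn u v ≤ degree u
    commonOut+commonIn≤degree u v = begin
      commonOut u v + commonIn u v                      ≡⟨ ∑-distrib-+ (sharedOut u v) (sharedIn u v) ⟨
      sum (λ x → sharedOut u v x + sharedIn u v x)      ≤⟨ sum-mono-≤ shared≤adjacent ⟩
      degree u                                          ∎
      where
      open ≤-Reasoning
      shared≤adjacent : ∀ x → sharedOut u v x + sharedIn u v x ≤ 𝟙 (adjacent u x)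
      shared≤adjacent x = 𝟙-disjoint (arc G u x) (arc G v x) (arc G x u) (arc G x v)
        λ (u→x , x→u) → arc-asymmetric G u x u→x x→u

    labellingsAt : Fin n → Fin n → ℕ
    labellingsAt u v = ∑² (HLabelling (arc G) u v)

    labellingsAt≤ : ∀ u v → labellingsAt u v ≤ nonadjacent u v * (commonOut u v * commonIn u v)
    labellingsAt≤ u v = begin
      labellingsAt u v                                                   ≤⟨ ∑²-mono-≤ split ⟩
      ∑² (λ x y → nonadjacent u v * (sharedOut u v x * sharedIn u v y))  ≡⟨ *-distribˡ-∑² (nonadjacent u v) (λ x y → sharedOut u v x * sharedIn u v y) ⟨
      nonadjacent u v * ∑² (λ x y → sharedOut u v x * sharedIn u v y)    ≡⟨ cong (nonadjacent u v *_) (∑²-product (sharedOut u v) (sharedIn u v)) ⟩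
      nonadjacent u v * (commonOut u v * commonIn u v)                   ∎
      where
      open ≤-Reasoning
      split : ∀ x y → HLabelling (arc G) u v x y ≤ nonadjacent u v * (sharedOut u v x * sharedIn u v y)
      split x y = 𝟙-split (not (adjacent u v)) (arc G u x) (arc G v x) (arc G x y) (arc G y u) (arc G y v)

    4*labellingsAt≤ : ∀ u v → 4 * labellingsAt u v ≤ nonadjacent u v * (degree u * degree u)
    4*labellingsAt≤ u v = begin
      4 * labellingsAt u v                          ≤⟨ *-monoʳ-≤ 4 (labellingsAt≤ u v) ⟩
      4 * (N * (X * Y))                             ≡⟨ x∙yz≈y∙xz 4 N (X * Y) ⟩
      N * (4 * (X * Y))                             ≤⟨ *-monoʳ-≤ N (4xy≤[x+y]² X Y) ⟩
      N * ((X + Y) * (X + Y))                       ≤⟨ *-monoʳ-≤ N (*-mono-≤ (commonOut+commonIn≤degree u v) (commonOut+commonIn≤degree u v)) ⟩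
      N * (degree u * degree u)                     ∎
      where
      open ≤-Reasoning
      N = nonadjacent u v
      X = commonOut u v
      Y = commonIn u v

    27*labellings≤n⁴ : 27 * labellings G ≤ n * n * n * n
    27*labellings≤n⁴ = *-cancelˡ-≤ 4 (begin
      4 * (27 * labellings G)                                  ≡⟨ x∙yz≈y∙xz 4 27 (labellings G) ⟩
      27 * (4 * ∑² labellingsAt)                               ≡⟨ cong (27 *_) (*-distribˡ-∑² 4 labellingsAt) ⟩
      27 * ∑² (λ u v → 4 * labellingsAt u v)                   ≤⟨ *-monoʳ-≤ 27 (∑²-mono-≤ 4*labellingsAt≤) ⟩
      27 * ∑² (λ u v → nonadjacent u v * (degree u * degree u)) ≡⟨ cong (27 *_) (sum-cong-≗ λ u → *-distribʳ-sum (degree u * degree u) (nonadjacent u)) ⟨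
      27 * sum (λ u → nondegree u * (degree u * degree u))     ≡⟨ *-distribˡ-sum 27 (λ u → nondegree u * (degree u * degree u)) ⟩
      sum (λ u → 27 * (nondegree u * (degree u * degree u)))   ≤⟨ sum-mono-≤ per-vertex ⟩
      sum {n} (λ _ → 4 * (n * n * n))                          ≡⟨ sum-const n (4 * (n * n * n)) ⟩
      n * (4 * (n * n * n))                                    ≡⟨ rearrange n ⟩
      4 * (n * n * n * n)                                      ∎)
      where
      open ≤-Reasoning
      per-vertex : ∀ u → 27 * (nondegree u * (degree u * degree u)) ≤ 4 * (n * n * n)
      per-vertex u = begin
        27 * (nondegree u * (degree u * degree u))     ≡⟨ *-assoc 27 (nondegree u) _ ⟨
        27 * nondegree u * (degree u * degree u)       ≤⟨ 27ab²≤4[a+b]³ (nondegree u) (degree u) ⟩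
        4 * ((nondegree u + degree u) * (nondegree u + degree u) * (nondegree u + degree u)) ≡⟨ cong (λ m → 4 * (m * m * m)) (nondegree+degree≡n u) ⟩
        4 * (n * n * n)                                ∎
      rearrange : ∀ n → n * (4 * (n * n * n)) ≡ 4 * (n * n * n * n)
      rearrange = solve-∀

  54*countH≤n⁴ : ∀ {n} (G : OGraph n) → 54 * countH G ≤ n * n * n * n
  54*countH≤n⁴ G = begin
    54 * countH G                   ≡⟨ *-assoc 27 2 (countH G) ⟩
    27 * (2 * countH G)             ≤⟨ *-monoʳ-≤ 27 (2*countH≤labellings G) ⟩
    27 * labellings G               ≤⟨ 27*labellings≤n⁴ G ⟩
    _                               ∎
    where open ≤-Reasoning


module Construction where
  open import Data.Bool using (Bool; true; false; T; not; _∧_; _∨_)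
  open import Data.Bool.Properties using (T-≡; T-not-≡)
  open import Data.Empty using (⊥-elim)
  open import Data.Fin using (Fin; zero; suc; toℕ)
  open import Data.Nat using (ℕ; zero; suc; _+_; _*_; _⊓_; _≤_; _<_; _<ᵇ_; _≤ᵇ_; z≤n; s≤s)
  open import Data.Nat.Properties
  open import Data.Nat.Tactic.RingSolver using (solve-∀)
  open import Data.Product using (_×_; _,_; proj₁; proj₂)
  open import Data.Vec using (Vec; []; _∷_)
  open import Function using (Equivalence)
  open import Relation.Binary.PropositionalEquality using (_≡_; refl; cong; cong₂; trans; sym; subst; subst₂; module ≡-Reasoning)
  open FinSum
  open FiniteSearch
  open Symmetrisation
  open FourVertices
  open Counting

  data Part : Set where
    P₀ P₁ P₂ spare : Part

  cyclic : Part → Part → Bool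
  cyclic P₀ P₁ = true
  cyclic P₁ P₂ = true
  cyclic P₂ P₀ = true
  cyclic _  _  = false

  cyclic-irreflexive : ∀ p → cyclic p p ≡ false
  cyclic-irreflexive P₀    = refl
  cyclic-irreflexive P₁    = refl
  cyclic-irreflexive P₂    = refl
  cyclic-irreflexive spare = refl

  cyclic-asymmetric : ∀ p q → cyclic p q ≡ true → cyclic q p ≡ false
  cyclic-asymmetric P₀ P₁ _ = refl
  cyclic-asymmetric P₁ P₂ _ = refl
  cyclic-asymmetric P₂ P₀ _ = refl
  cyclic-asymmetric P₀ P₀ ()
  cyclic-asymmetric P₀ P₂ ()
  cyclic-asymmetric P₀ spare ()
  cyclic-asymmetric P₁ P₀ ()
  cyclic-asymmetric P₁ P₁ ()
  cyclic-asymmetric P₁ spare ()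
  cyclic-asymmetric P₂ P₁ ()
  cyclic-asymmetric P₂ P₂ ()
  cyclic-asymmetric P₂ spare ()
  cyclic-asymmetric spare _ ()

  rank : Part → ℕ
  rank P₀    = 0
  rank P₁    = 1
  rank P₂    = 2
  rank spare = 3

  toPart : ℕ → Part
  toPart 0 = P₀
  toPart 1 = P₁
  toPart 2 = P₂
  toPart _ = spare

  rank-toPart : ∀ x → rank (toPart x) ≡ x ⊓ 3
  rank-toPart 0                   = refl
  rank-toPart 1                   = refl
  rank-toPart 2                   = refl
  rank-toPart (suc (suc (suc x))) = cong (λ y → suc (suc (suc y))) (sym (⊓-zeroʳ x))

  toPart-mono : ∀ {x y} → x ≤ y → rank (toPart x) ≤ rank (toPart y)
  toPart-mono {x} {y} x≤y = subst₂ _≤_ (sym (rank-toPart x)) (sym (rank-toPart y)) (⊓-monoˡ-≤ 3 x≤y)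

  atLeast : ℕ → ℕ → Bool
  atLeast c t = not (t <ᵇ c)

  atLeast-mono : ∀ c {t t′} → t ≤ t′ → 𝟙 (atLeast c t) ≤ 𝟙 (atLeast c t′)
  atLeast-mono c {t} {t′} t≤t′ with t <ᵇ c in t≮c | t′ <ᵇ c in t′<c
  ... | true  | _     = z≤n
  ... | false | false = ≤-refl
  ... | false | true  = ⊥-elim (subst T t≮c (<⇒<ᵇ (≤-<-trans t≤t′ (<ᵇ⇒< t′ c (Equivalence.from T-≡ t′<c)))))

  atLeast-antitone : ∀ {c c′} t → c ≤ c′ → T (atLeast c′ t) → T (atLeast c t)
  atLeast-antitone {c} {c′} t c≤c′ t≥c′ = T-not-intro λ t<c →
    subst T (Equivalence.to T-not-≡ t≥c′) (<⇒<ᵇ (<-≤-trans (<ᵇ⇒< t c t<c) c≤c′))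

  #atLeast : ∀ n c → c ≤ n → sum {n} (λ x → 𝟙 (atLeast c (toℕ x))) + c ≡ n
  #atLeast n       zero    _         = trans (+-identityʳ _) (trans (sum-const n 1) (*-identityʳ n))
  #atLeast (suc n) (suc c) (s≤s c≤n) = trans (+-suc _ c) (cong suc (#atLeast n c c≤n))

  level : ℕ → ℕ → ℕ
  level m t = 𝟙 (atLeast m t) + 𝟙 (atLeast (m + m) t) + 𝟙 (atLeast (m + m + m) t)

  level-mono : ∀ m {t t′} → t ≤ t′ → level m t ≤ level m t′
  level-mono m t≤t′ = +-mono-≤ (+-mono-≤ (atLeast-mono m t≤t′) (atLeast-mono (m + m) t≤t′)) (atLeast-mono (m + m + m) t≤t′)

  -- Vertex t lies in P₀, P₁ or P₂ according as t < m, m ≤ t < 2m or 2m ≤ t < 3m; the remaining vertices are spare.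
  part : ℕ → ℕ → Part
  part m t = toPart (level m t)

  earlier : Part → Part → Bool
  earlier p q = rank p <ᵇ rank q

  earlier⇒< : ∀ m a b → T (earlier (part m a) (part m b)) → T (a <ᵇ b)
  earlier⇒< m a b earlier-ab with a <ᵇ b in a<b
  ... | true  = _
  ... | false = <⇒≱ (<ᵇ⇒< (rank (part m a)) (rank (part m b)) earlier-ab) (toPart-mono (level-mono m b≤a))
    where
    b≤a : b ≤ a
    b≤a = ≮⇒≥ λ a<b′ → subst T a<b (<⇒<ᵇ a<b′)

  blowUp : ℕ → (n : ℕ) → OGraph n
  blowUp m n = record
    { arc      = λ i j → cyclic (part m (toℕ i)) (part m (toℕ j))
    ; loopless = λ i → cyclic-irreflexive (part m (toℕ i))
    ; asym     = λ i j → cyclic-asymmetric (part m (toℕ i)) (part m (toℕ j))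
    }

  inPart : Part → Part → ℕ
  inPart P₀    P₀    = 1
  inPart P₁    P₁    = 1
  inPart P₂    P₂    = 1
  inPart _     _     = 0

  inPart≤1 : ∀ p q → inPart p q ≤ 1
  inPart≤1 P₀    P₀    = ≤-refl
  inPart≤1 P₁    P₁    = ≤-refl
  inPart≤1 P₂    P₂    = ≤-refl
  inPart≤1 P₀    P₁    = z≤n
  inPart≤1 P₀    P₂    = z≤n
  inPart≤1 P₀    spare = z≤n
  inPart≤1 P₁    P₀    = z≤n
  inPart≤1 P₁    P₂    = z≤n
  inPart≤1 P₁    spare = z≤n
  inPart≤1 P₂    P₀    = z≤n
  inPart≤1 P₂    P₁    = z≤n
  inPart≤1 P₂    spare = z≤n
  inPart≤1 spare _     = z≤n

  thresholds : ∀ a b c → (T b → T a) → (T c → T b) →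
    (inPart P₀ (toPart (𝟙 a + 𝟙 b + 𝟙 c)) + 𝟙 a ≡ 1) ×
    (inPart P₁ (toPart (𝟙 a + 𝟙 b + 𝟙 c)) + 𝟙 b ≡ 𝟙 a) ×
    (inPart P₂ (toPart (𝟙 a + 𝟙 b + 𝟙 c)) + 𝟙 c ≡ 𝟙 b)
  thresholds false false false _   _   = refl , refl , refl
  thresholds true  false false _   _   = refl , refl , refl
  thresholds true  true  false _   _   = refl , refl , refl
  thresholds true  true  true  _   _   = refl , refl , refl
  thresholds false true  _     b⇒a _   = ⊥-elim (b⇒a _)
  thresholds _     false true  _   c⇒b = ⊥-elim (c⇒b _)

  families : Bool → Bool → Bool → Part → Part → Part → Part → ℕ
  families u₁ u₂ u₃ p₁ p₂ p₃ p₄ =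
    𝟙 u₁ * (inPart P₀ p₁ * inPart P₀ p₂) * (inPart P₁ p₃ * inPart P₂ p₄) +
    inPart P₀ p₁ * (𝟙 u₂ * (inPart P₁ p₂ * inPart P₁ p₃) * inPart P₂ p₄) +
    inPart P₀ p₁ * inPart P₁ p₂ * (𝟙 u₃ * (inPart P₂ p₃ * inPart P₂ p₄))

  everyPart : Enumeration Part
  everyPart p = p P₀ ∧ p P₁ ∧ p P₂ ∧ p spare

  everyPart-complete : Complete everyPart
  everyPart-complete p all-p P₀    = T-∧-elimˡ (p P₀) all-p
  everyPart-complete p all-p P₁    = T-∧-elimˡ (p P₁) (T-∧-elimʳ (p P₀) all-p)
  everyPart-complete p all-p P₂    = T-∧-elimˡ (p P₂) (T-∧-elimʳ (p P₁) (T-∧-elimʳ (p P₀) all-p))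
  everyPart-complete p all-p spare = T-∧-elimʳ (p P₂) (T-∧-elimʳ (p P₁) (T-∧-elimʳ (p P₀) all-p))

  private
    familiesᵇ : Vec Bool 3 → Vec Part 4 → Bool
    familiesᵇ (u₁ ∷ u₂ ∷ u₃ ∷ []) (p₁ ∷ p₂ ∷ p₃ ∷ p₄ ∷ []) =
      not ((not (earlier p₁ p₂) ∨ u₁) ∧ (not (earlier p₂ p₃) ∨ u₂) ∧ (not (earlier p₃ p₄) ∨ u₃)) ∨
      (families u₁ u₂ u₃ p₁ p₂ p₃ p₄ ≤ᵇ 𝟙 (u₁ ∧ u₂ ∧ u₃) * 𝟙 (inducesH₄ (restrict cyclic p₁ p₂ p₃ p₄)))

    familiesᵇ-check : everyVec everyBool 3 (λ us → everyVec everyPart 4 (familiesᵇ us)) ≡ true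
    familiesᵇ-check = refl

  families≤increasing-induced : ∀ u₁ u₂ u₃ p₁ p₂ p₃ p₄ →
    (T (earlier p₁ p₂) → T u₁) → (T (earlier p₂ p₃) → T u₂) → (T (earlier p₃ p₄) → T u₃) →
    families u₁ u₂ u₃ p₁ p₂ p₃ p₄ ≤ 𝟙 (u₁ ∧ u₂ ∧ u₃) * 𝟙 (inducesH₄ (restrict cyclic p₁ p₂ p₃ p₄))
  families≤increasing-induced u₁ u₂ u₃ p₁ p₂ p₃ p₄ ⇒u₁ ⇒u₂ ⇒u₃ = ≤ᵇ⇒≤ _ _ (T-⇒-elim check consistent)
    where
    us = u₁ ∷ u₂ ∷ u₃ ∷ []
    check : T (familiesᵇ us (p₁ ∷ p₂ ∷ p₃ ∷ p₄ ∷ []))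
    check = everyVec-complete everyPart-complete 4 (familiesᵇ us)
      (everyVec-complete everyBool-complete 3 (λ us → everyVec everyPart 4 (familiesᵇ us)) (Equivalence.from T-≡ familiesᵇ-check) us)
      (p₁ ∷ p₂ ∷ p₃ ∷ p₄ ∷ [])
    consistent = T-∧-intro (T-⇒-intro ⇒u₁) (T-∧-intro (T-⇒-intro ⇒u₂) (T-⇒-intro ⇒u₃))

  module _ (m n : ℕ) (3m≤n : 3 * m ≤ n) where
    private
      m+m+m≤n : m + m + m ≤ n
      m+m+m≤n = subst (_≤ n) (triple m) 3m≤n
        where
        triple : ∀ m → 3 * m ≡ m + m + m
        triple = solve-∀

      label : Fin n → Part
      label x = part m (toℕ x)

      e : Part → Fin n → ℕ
      e p x = inPart p (label x)

      A B C : Fin n → ℕ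
      A x = 𝟙 (atLeast m (toℕ x))
      B x = 𝟙 (atLeast (m + m) (toℕ x))
      C x = 𝟙 (atLeast (m + m + m) (toℕ x))

      membership : ∀ x → (e P₀ x + A x ≡ 1) × (e P₁ x + B x ≡ A x) × (e P₂ x + C x ≡ B x)
      membership x = thresholds _ _ _ (atLeast-antitone (toℕ x) (m≤m+n m m)) (atLeast-antitone (toℕ x) (m≤m+n (m + m) m))

      sum-difference : (f g h : Fin n → ℕ) (c : ℕ) → (∀ x → f x + g x ≡ h x) → sum h ≡ sum g + c → sum f ≡ c
      sum-difference f g h c f+g≡h h≡g+c = +-cancelʳ-≡ (sum g) (sum f) c (begin
        sum f + sum g               ≡⟨ ∑-distrib-+ f g ⟨
        sum (λ x → f x + g x)       ≡⟨ sum-cong-≗ f+g≡h ⟩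
        sum h                       ≡⟨ h≡g+c ⟩
        sum g + c                   ≡⟨ +-comm (sum g) c ⟩
        c + sum g                   ∎)
        where open ≡-Reasoning

      #A : sum A + m ≡ n
      #A = #atLeast n m (≤-trans (≤-trans (m≤m+n m m) (m≤m+n (m + m) m)) m+m+m≤n)
      #B : sum B + (m + m) ≡ n
      #B = #atLeast n (m + m) (≤-trans (m≤m+n (m + m) m) m+m+m≤n)
      #C : sum C + (m + m + m) ≡ n
      #C = #atLeast n (m + m + m) m+m+m≤n

    size-P₀ : sum (e P₀) ≡ m
    size-P₀ = sum-difference (e P₀) A (λ _ → 1) m (λ x → proj₁ (membership x))
      (trans (trans (sum-const n 1) (*-identityʳ n)) (sym #A))

    size-P₁ : sum (e P₁) ≡ m
    size-P₁ = sum-difference (e P₁) B A m (λ x → proj₁ (proj₂ (membership x)))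
      (+-cancelʳ-≡ m (sum A) (sum B + m) (trans #A (trans (sym #B) (sym (+-assoc (sum B) m m)))))

    size-P₂ : sum (e P₂) ≡ m
    size-P₂ = sum-difference (e P₂) C B m (λ x → proj₂ (proj₂ (membership x)))
      (+-cancelʳ-≡ (m + m) (sum B) (sum C + m) (trans #B (trans (sym #C) (regroup (sum C) m))))
      where
      regroup : ∀ c m → c + (m + m + m) ≡ c + m + (m + m)
      regroup = solve-∀

    familyCount : Quad (Fin n)
    familyCount i j k l = families (i <ᶠ j) (j <ᶠ k) (k <ᶠ l) (label i) (label j) (label k) (label l)

    ∑⁴-familyCount : ∑⁴ familyCount ≡ orderedPairs (e P₀) * (m * m) + m * (orderedPairs (e P₁) * m) + m * m * orderedPairs (e P₂)
    ∑⁴-familyCount = begin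
      ∑⁴ familyCount                                         ≡⟨ ∑⁴-distrib-+ (λ i j k l → F₁ i j k l + F₂ i j k l) F₃ ⟩
      ∑⁴ (λ i j k l → F₁ i j k l + F₂ i j k l) + ∑⁴ F₃       ≡⟨ cong (_+ ∑⁴ F₃) (∑⁴-distrib-+ F₁ F₂) ⟩
      ∑⁴ F₁ + ∑⁴ F₂ + ∑⁴ F₃                                  ≡⟨ cong₂ _+_ (cong₂ _+_ ∑⁴F₁ ∑⁴F₂) ∑⁴F₃ ⟩
      orderedPairs (e P₀) * (m * m) + m * (orderedPairs (e P₁) * m) + m * m * orderedPairs (e P₂) ∎
      where
      open ≡-Reasoning
      F₁ F₂ F₃ : Quad (Fin n)
      F₁ i j k l = 𝟙 (i <ᶠ j) * (e P₀ i * e P₀ j) * (e P₁ k * e P₂ l)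
      F₂ i j k l = e P₀ i * (𝟙 (j <ᶠ k) * (e P₁ j * e P₁ k) * e P₂ l)
      F₃ i j k l = e P₀ i * e P₁ j * (𝟙 (k <ᶠ l) * (e P₂ k * e P₂ l))
      ∑⁴F₁ : ∑⁴ F₁ ≡ orderedPairs (e P₀) * (m * m)
      ∑⁴F₁ = trans (∑⁴-product (λ i j → 𝟙 (i <ᶠ j) * (e P₀ i * e P₀ j)) (λ k l → e P₁ k * e P₂ l))
        (cong (orderedPairs (e P₀) *_) (trans (∑²-product (e P₁) (e P₂)) (cong₂ _*_ size-P₁ size-P₂)))
      ∑⁴F₂ : ∑⁴ F₂ ≡ m * (orderedPairs (e P₁) * m)
      ∑⁴F₂ = trans (∑⁴-middle-product (e P₀) (λ j k → 𝟙 (j <ᶠ k) * (e P₁ j * e P₁ k)) (e P₂))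
        (cong₂ (λ s t → s * (orderedPairs (e P₁) * t)) size-P₀ size-P₂)
      ∑⁴F₃ : ∑⁴ F₃ ≡ m * m * orderedPairs (e P₂)
      ∑⁴F₃ = trans (∑⁴-product (λ i j → e P₀ i * e P₁ j) (λ k l → 𝟙 (k <ᶠ l) * (e P₂ k * e P₂ l)))
        (cong (_* orderedPairs (e P₂)) (trans (∑²-product (e P₀) (e P₁)) (cong₂ _*_ size-P₀ size-P₁)))

    ∑⁴-familyCount≤countH : ∑⁴ familyCount ≤ countH (blowUp m n)
    ∑⁴-familyCount≤countH = ≤-trans
      (∑⁴-mono-≤ λ i j k l → families≤increasing-induced (i <ᶠ j) (j <ᶠ k) (k <ᶠ l) (label i) (label j) (label k) (label l)
        (earlier⇒< m (toℕ i) (toℕ j)) (earlier⇒< m (toℕ j) (toℕ k)) (earlier⇒< m (toℕ k) (toℕ l)))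
      (≤-reflexive (sym (countH≡∑⁴ (blowUp m n))))

    3m⁴≤2*countH+3m³ : 3 * (m * m * m * m) ≤ 2 * countH (blowUp m n) + 3 * (m * m * m)
    3m⁴≤2*countH+3m³ = begin
      3 * (m * m * m * m)                                               ≡⟨ split m ⟩
      m * m * (m * m) + m * m * (m * m) + m * m * (m * m)               ≤⟨ +-mono-≤ (+-mono-≤ (pairs P₀ size-P₀) (pairs P₁ size-P₁)) (pairs P₂ size-P₂) ⟩
      m * m * (2 * Q₀ + m) + m * m * (2 * Q₁ + m) + m * m * (2 * Q₂ + m) ≡⟨ collect m Q₀ Q₁ Q₂ ⟩
      2 * (Q₀ * (m * m) + m * (Q₁ * m) + m * m * Q₂) + 3 * (m * m * m) ≡⟨ cong (λ t → 2 * t + 3 * (m * m * m)) (sym ∑⁴-familyCount) ⟩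
      2 * ∑⁴ familyCount + 3 * (m * m * m)                               ≤⟨ +-monoˡ-≤ (3 * (m * m * m)) (*-monoʳ-≤ 2 ∑⁴-familyCount≤countH) ⟩
      2 * countH (blowUp m n) + 3 * (m * m * m)                          ∎
      where
      open ≤-Reasoning
      Q₀ = orderedPairs (e P₀)
      Q₁ = orderedPairs (e P₁)
      Q₂ = orderedPairs (e P₂)
      pairs : ∀ p → sum (e p) ≡ m → m * m * (m * m) ≤ m * m * (2 * orderedPairs (e p) + m)
      pairs p size≡m = *-monoʳ-≤ (m * m) (subst (λ s → s * s ≤ 2 * orderedPairs (e p) + s) size≡m
        ([sum]²≤2*orderedPairs+sum (e p) (λ x → inPart≤1 p (label x))))
      split : ∀ m → 3 * (m * m * m * m) ≡ m * m * (m * m) + m * m * (m * m) + m * m * (m * m)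
      split = solve-∀
      collect : ∀ m Q₀ Q₁ Q₂ → m * m * (2 * Q₀ + m) + m * m * (2 * Q₁ + m) + m * m * (2 * Q₂ + m)
                             ≡ 2 * (Q₀ * (m * m) + m * (Q₁ * m) + m * m * Q₂) + 3 * (m * m * m)
      collect = solve-∀


module Binomial where
  open import Data.Nat using (zero; suc; _+_; _*_; _≤_; z≤n; s≤s)
  open import Data.Nat.Properties
  open import Data.Nat.Combinatorics using (_C_; nCk+nC[k+1]≡[n+1]C[k+1]; nC1≡n)
  open import Data.Nat.Tactic.RingSolver using (solve-∀)
  open import Relation.Binary.PropositionalEquality using (_≡_; refl; cong; cong₂; sym; module ≡-Reasoning)

  private
    pascal : ∀ n k → suc n C suc k ≡ n C k + n C suc k
    pascal n k = sym (nCk+nC[k+1]≡[n+1]C[k+1] n k)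

  2*[1+n]C2≡[1+n]*n : ∀ n → 2 * (suc n C 2) ≡ suc n * n
  2*[1+n]C2≡[1+n]*n zero = refl
  2*[1+n]C2≡[1+n]*n (suc n) = begin
    2 * ((2 + n) C 2)                        ≡⟨ cong (2 *_) (pascal (suc n) 1) ⟩
    2 * (suc n C 1 + suc n C 2)            ≡⟨ *-distribˡ-+ 2 (suc n C 1) _ ⟩
    2 * (suc n C 1) + 2 * (suc n C 2)      ≡⟨ cong₂ (λ a b → 2 * a + b) (nC1≡n (suc n)) (2*[1+n]C2≡[1+n]*n n) ⟩
    2 * suc n + suc n * n                  ≡⟨ expand n ⟩
    (2 + n) * suc n                        ∎
    where
    open ≡-Reasoning
    expand : ∀ n → 2 * suc n + suc n * n ≡ (2 + n) * suc n
    expand = solve-∀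

  6*[2+n]C3≡[2+n]*[1+n]*n : ∀ n → 6 * ((2 + n) C 3) ≡ (2 + n) * (1 + n) * n
  6*[2+n]C3≡[2+n]*[1+n]*n zero = refl
  6*[2+n]C3≡[2+n]*[1+n]*n (suc n) = begin
    6 * ((3 + n) C 3)                        ≡⟨ cong (6 *_) (pascal (2 + n) 2) ⟩
    6 * ((2 + n) C 2 + (2 + n) C 3)            ≡⟨ *-distribˡ-+ 6 ((2 + n) C 2) _ ⟩
    6 * ((2 + n) C 2) + 6 * ((2 + n) C 3)      ≡⟨ cong (_+ 6 * ((2 + n) C 3)) (*-assoc 3 2 ((2 + n) C 2)) ⟩
    3 * (2 * ((2 + n) C 2)) + 6 * ((2 + n) C 3)      ≡⟨ cong₂ (λ a b → 3 * a + b) (2*[1+n]C2≡[1+n]*n (suc n)) (6*[2+n]C3≡[2+n]*[1+n]*n n) ⟩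
    3 * ((2 + n) * (1 + n)) + (2 + n) * (1 + n) * n ≡⟨ expand n ⟩
    (3 + n) * (2 + n) * (1 + n)            ∎
    where
    open ≡-Reasoning
    expand : ∀ n → 3 * ((2 + n) * (1 + n)) + (2 + n) * (1 + n) * n ≡ (3 + n) * (2 + n) * (1 + n)
    expand = solve-∀

  24*[3+n]C4≡[3+n]*[2+n]*[1+n]*n : ∀ n → 24 * ((3 + n) C 4) ≡ (3 + n) * (2 + n) * (1 + n) * n
  24*[3+n]C4≡[3+n]*[2+n]*[1+n]*n zero = refl
  24*[3+n]C4≡[3+n]*[2+n]*[1+n]*n (suc n) = begin
    24 * ((4 + n) C 4)                        ≡⟨ cong (24 *_) (pascal (3 + n) 3) ⟩
    24 * ((3 + n) C 3 + (3 + n) C 4)            ≡⟨ *-distribˡ-+ 24 ((3 + n) C 3) _ ⟩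
    24 * ((3 + n) C 3) + 24 * ((3 + n) C 4)     ≡⟨ cong (_+ 24 * ((3 + n) C 4)) (*-assoc 4 6 ((3 + n) C 3)) ⟩
    4 * (6 * ((3 + n) C 3)) + 24 * ((3 + n) C 4)     ≡⟨ cong₂ (λ a b → 4 * a + b) (6*[2+n]C3≡[2+n]*[1+n]*n (suc n)) (24*[3+n]C4≡[3+n]*[2+n]*[1+n]*n n) ⟩
    4 * ((3 + n) * (2 + n) * (1 + n)) + (3 + n) * (2 + n) * (1 + n) * n ≡⟨ expand n ⟩
    (4 + n) * (3 + n) * (2 + n) * (1 + n)   ∎
    where
    open ≡-Reasoning
    expand : ∀ n → 4 * ((3 + n) * (2 + n) * (1 + n)) + (3 + n) * (2 + n) * (1 + n) * n ≡ (4 + n) * (3 + n) * (2 + n) * (1 + n)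
    expand = solve-∀

  24*nC4≤n⁴ : ∀ n → 24 * (n C 4) ≤ n * n * n * n
  24*nC4≤n⁴ 0 = z≤n
  24*nC4≤n⁴ 1 = z≤n
  24*nC4≤n⁴ 2 = z≤n
  24*nC4≤n⁴ (suc (suc (suc r))) = begin
    24 * ((3 + r) C 4)                    ≡⟨ 24*[3+n]C4≡[3+n]*[2+n]*[1+n]*n r ⟩
    (3 + r) * (2 + r) * (1 + r) * r     ≤⟨ *-mono-≤ (*-mono-≤ (*-monoʳ-≤ (3 + r) (m≤n+m (2 + r) 1)) (m≤n+m (1 + r) 2)) (m≤n+m r 3) ⟩
    (3 + r) * (3 + r) * (3 + r) * (3 + r) ∎
    where open ≤-Reasoning

  n⁴≤24*nC4+6*n³ : ∀ n → n * n * n * n ≤ 24 * (n C 4) + 6 * (n * n * n)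
  n⁴≤24*nC4+6*n³ 0 = z≤n
  n⁴≤24*nC4+6*n³ 1 = s≤s z≤n
  n⁴≤24*nC4+6*n³ 2 = ≤ᵇ⇒≤ 16 48 _
  n⁴≤24*nC4+6*n³ (suc (suc (suc r))) = begin
    (3 + r) * (3 + r) * (3 + r) * (3 + r)                                          ≤⟨ m≤m+n ((3 + r) * (3 + r) * (3 + r) * (3 + r)) ((3 + r) * (11 * r + 27)) ⟩
    (3 + r) * (3 + r) * (3 + r) * (3 + r) + (3 + r) * (11 * r + 27)                 ≡⟨ expand r ⟩
    (3 + r) * (2 + r) * (1 + r) * r + 6 * ((3 + r) * (3 + r) * (3 + r))     ≡⟨ cong (_+ 6 * ((3 + r) * (3 + r) * (3 + r))) (sym (24*[3+n]C4≡[3+n]*[2+n]*[1+n]*n r)) ⟩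
    24 * ((3 + r) C 4) + 6 * ((3 + r) * (3 + r) * (3 + r))                    ∎
    where
    open ≤-Reasoning
    expand : ∀ r → (3 + r) * (3 + r) * (3 + r) * (3 + r) + (3 + r) * (11 * r + 27) ≡ (3 + r) * (2 + r) * (1 + r) * r + 6 * ((3 + r) * (3 + r) * (3 + r))
    expand = solve-∀

  a*n³≤216*nC4 : ∀ a n → a + 54 ≤ 9 * n → a * (n * n * n) ≤ 216 * (n C 4)
  a*n³≤216*nC4 a n a+54≤9n = +-cancelʳ-≤ (54 * (n * n * n)) (a * (n * n * n)) (216 * (n C 4)) (begin
    a * (n * n * n) + 54 * (n * n * n)         ≡⟨ sym (*-distribʳ-+ (n * n * n) a 54) ⟩
    (a + 54) * (n * n * n)               ≤⟨ *-monoˡ-≤ (n * n * n) a+54≤9n ⟩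
    9 * n * (n * n * n)                  ≡⟨ reassoc 9 n ⟩
    9 * (n * n * n * n)                      ≤⟨ *-monoʳ-≤ 9 (n⁴≤24*nC4+6*n³ n) ⟩
    9 * (24 * (n C 4) + 6 * (n * n * n))   ≡⟨ distrib (n C 4) (n * n * n) ⟩
    216 * (n C 4) + 54 * (n * n * n)       ∎)
    where
    open ≤-Reasoning
    reassoc : ∀ a n → a * n * (n * n * n) ≡ a * (n * n * n * n)
    reassoc = solve-∀
    distrib : ∀ c m → 9 * (24 * c + 6 * m) ≡ 216 * c + 54 * m
    distrib = solve-∀

module Estimates where
  open import Data.Nat using (zero; suc; _+_; _*_; _≤_)
  open import Data.Nat.Properties
  open import Data.Nat.Combinatorics using (_C_)
  open import Data.Nat.Tactic.RingSolver using (solve-∀)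
  open import Relation.Binary.PropositionalEquality using (_≡_; cong; sym)
  open import Relation.Nullary using (contradiction)
  open Binomial

  upper-estimate : ∀ D n c → 24 * D + 54 ≤ 9 * n → 54 * c ≤ n * n * n * n → 9 * D * c ≤ (4 * D + 9) * (n C 4)
  upper-estimate D n c 24D+54≤9n 54c≤n⁴ = begin
    9 * D * c                          ≤⟨ *-cancelˡ-≤ 6 six-fold ⟩
    4 * D * (n C 4) + D * n³            ≤⟨ +-monoʳ-≤ (4 * D * (n C 4)) D*n³≤9*nC4 ⟩
    4 * D * (n C 4) + 9 * (n C 4)       ≡⟨ sym (*-distribʳ-+ (n C 4) (4 * D) 9) ⟩
    (4 * D + 9) * (n C 4)              ∎
    where
    open ≤-Reasoning
    n³ = n * n * n
    six-fold : 6 * (9 * D * c) ≤ 6 * (4 * D * (n C 4) + D * n³)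
    six-fold = begin
      6 * (9 * D * c)                   ≡⟨ regroup₁ D c ⟩
      D * (54 * c)                      ≤⟨ *-monoʳ-≤ D (≤-trans 54c≤n⁴ (n⁴≤24*nC4+6*n³ n)) ⟩
      D * (24 * (n C 4) + 6 * n³)        ≡⟨ regroup₂ D (n C 4) n³ ⟩
      6 * (4 * D * (n C 4) + D * n³)     ∎
      where
      regroup₁ : ∀ D c → 6 * (9 * D * c) ≡ D * (54 * c)
      regroup₁ = solve-∀
      regroup₂ : ∀ D C m → D * (24 * C + 6 * m) ≡ 6 * (4 * D * C + D * m)
      regroup₂ = solve-∀
    D*n³≤9*nC4 : D * n³ ≤ 9 * (n C 4)
    D*n³≤9*nC4 = *-cancelˡ-≤ 24 (begin
      24 * (D * n³)       ≡⟨ sym (*-assoc 24 D n³) ⟩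
      24 * D * n³         ≤⟨ a*n³≤216*nC4 (24 * D) n 24D+54≤9n ⟩
      216 * (n C 4)       ≡⟨ *-assoc 24 9 (n C 4) ⟩
      24 * (9 * (n C 4))  ∎)

  private
    cubic-dominates : ∀ t → let m = suc t in 1188 * (m * m * m) + 864 * (m * m) + 384 * m + 64 ≤ 2500 * (m * m * m)
    cubic-dominates t = ≤-trans (m≤m+n _ (1312 * (t * t * t) + 3072 * (t * t) + 1824 * t)) (≤-reflexive (slack t))
      where
      slack : ∀ t → 1188 * (suc t * suc t * suc t) + 864 * (suc t * suc t) + 384 * suc t + 64 + (1312 * (t * t * t) + 3072 * (t * t) + 1824 * t)
                  ≡ 2500 * (suc t * suc t * suc t)
      slack = solve-∀

  lower-estimate : ∀ D n m c → 93 * D + 54 ≤ 9 * n → 3 * m ≤ n → n ≤ 3 * m + 2 →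
    3 * (m * m * m * m) ≤ 2 * c + 3 * (m * m * m) → 4 * D * (n C 4) ≤ 9 * D * c + 9 * (n C 4)
  lower-estimate D n zero c 93D+54≤9n _ n≤2 _ = contradiction 93D+54≤9n (<⇒≱ (begin-strict
    9 * n          ≤⟨ *-monoʳ-≤ 9 n≤2 ⟩
    18             <⟨ ≤ᵇ⇒≤ 19 54 _ ⟩
    54             ≤⟨ m≤n+m 54 (93 * D) ⟩
    93 * D + 54    ∎))
    where open ≤-Reasoning
  lower-estimate D n m@(suc t) c 93D+54≤9n 3m≤n n≤3m+2 count = *-cancelˡ-≤ 24 (begin
    24 * (4 * D * (n C 4))                   ≡⟨ reassociate D (n C 4) ⟩
    4 * D * (24 * (n C 4))                   ≤⟨ *-monoʳ-≤ (4 * D) (≤-trans (24*nC4≤n⁴ n) (fourth-power-mono n≤3m+2)) ⟩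
    4 * D * ((3 * m + 2) * (3 * m + 2) * (3 * m + 2) * (3 * m + 2)) ≡⟨ expand D m ⟩
    D * (108 * (3 * (m * m * m * m)) + E)   ≤⟨ *-monoʳ-≤ D (+-monoˡ-≤ E (*-monoʳ-≤ 108 count)) ⟩
    D * (108 * (2 * c + 3 * M³) + E)        ≡⟨ regroup D c m ⟩
    24 * (9 * D * c) + D * E′               ≤⟨ +-monoʳ-≤ (24 * (9 * D * c)) (*-monoʳ-≤ D (cubic-dominates t)) ⟩
    24 * (9 * D * c) + D * (2500 * M³)      ≤⟨ +-monoʳ-≤ (24 * (9 * D * c)) cubic-term ⟩
    24 * (9 * D * c) + 216 * (n C 4)        ≡⟨ cong (24 * (9 * D * c) +_) (*-assoc 24 9 (n C 4)) ⟩
    24 * (9 * D * c) + 24 * (9 * (n C 4))   ≡⟨ *-distribˡ-+ 24 (9 * D * c) (9 * (n C 4)) ⟨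
    24 * (9 * D * c + 9 * (n C 4))          ∎)
    where
    open ≤-Reasoning
    M³ = m * m * m
    E  = 864 * M³ + 864 * (m * m) + 384 * m + 64
    E′ = 1188 * M³ + 864 * (m * m) + 384 * m + 64
    fourth-power-mono : ∀ {a b} → a ≤ b → a * a * a * a ≤ b * b * b * b
    fourth-power-mono a≤b = *-mono-≤ (*-mono-≤ (*-mono-≤ a≤b a≤b) a≤b) a≤b
    cubic-term : D * (2500 * M³) ≤ 216 * (n C 4)
    cubic-term = begin
      D * (2500 * M³)                          ≤⟨ *-monoʳ-≤ D (*-monoˡ-≤ M³ (≤ᵇ⇒≤ 2500 2511 _)) ⟩
      D * (2511 * M³)                          ≡⟨ scale D m ⟩
      93 * D * ((3 * m) * (3 * m) * (3 * m))   ≤⟨ *-monoʳ-≤ (93 * D) (*-mono-≤ (*-mono-≤ 3m≤n 3m≤n) 3m≤n) ⟩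
      93 * D * (n * n * n)                     ≤⟨ a*n³≤216*nC4 (93 * D) n 93D+54≤9n ⟩
      216 * (n C 4)                            ∎
      where
      scale : ∀ D m → D * (2511 * (m * m * m)) ≡ 93 * D * ((3 * m) * (3 * m) * (3 * m))
      scale = solve-∀
    reassociate : ∀ D C → 24 * (4 * D * C) ≡ 4 * D * (24 * C)
    reassociate = solve-∀
    expand : ∀ D m → 4 * D * ((3 * m + 2) * (3 * m + 2) * (3 * m + 2) * (3 * m + 2))
                   ≡ D * (108 * (3 * (m * m * m * m)) + (864 * (m * m * m) + 864 * (m * m) + 384 * m + 64))
    expand = solve-∀
    regroup : ∀ D c m → D * (108 * (2 * c + 3 * (m * m * m)) + (864 * (m * m * m) + 864 * (m * m) + 384 * m + 64))
                      ≡ 24 * (9 * D * c) + D * (1188 * (m * m * m) + 864 * (m * m) + 384 * m + 64)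
    regroup = solve-∀


module Bounds where
  open import Data.Nat using (ℕ; _+_; _*_; _≤_; _/_; _%_)
  open import Data.Nat.Properties
  open import Data.Nat.Combinatorics using (_C_)
  open import Data.Nat.DivMod using (m≡m%n+[m/n]*n; m%n<n)
  open import Data.Nat.Tactic.RingSolver using (solve-∀)
  open import Data.Product using (_×_; _,_)
  open import Relation.Binary.PropositionalEquality using (_≡_; cong)
  open Estimates
  open UpperBound using (54*countH≤n⁴)
  open Construction using (blowUp; 3m⁴≤2*countH+3m³)

  threshold : ℕ → ℕ
  threshold D = 11 * D + 6

  balancedBlowUp : (n : ℕ) → OGraph n
  balancedBlowUp n = blowUp (n / 3) n

  private
    93D+54≤9n : ∀ D n → threshold D ≤ n → 93 * D + 54 ≤ 9 * n
    93D+54≤9n D n N≤n = begin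
      93 * D + 54        ≤⟨ +-monoˡ-≤ 54 (*-monoˡ-≤ D (≤ᵇ⇒≤ 93 99 _)) ⟩
      99 * D + 54        ≡⟨ scale D ⟩
      9 * (11 * D + 6)   ≤⟨ *-monoʳ-≤ 9 N≤n ⟩
      9 * n              ∎
      where
      open ≤-Reasoning
      scale : ∀ D → 99 * D + 54 ≡ 9 * (11 * D + 6)
      scale = solve-∀

    thirds : ∀ n → 3 * (n / 3) ≤ n × n ≤ 3 * (n / 3) + 2
    thirds n = lower , upper
      where
      open ≤-Reasoning
      lower : 3 * (n / 3) ≤ n
      lower = begin
        3 * (n / 3)            ≡⟨ *-comm 3 (n / 3) ⟩
        n / 3 * 3              ≤⟨ m≤n+m (n / 3 * 3) (n % 3) ⟩
        n % 3 + n / 3 * 3      ≡⟨ m≡m%n+[m/n]*n n 3 ⟨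
        n                      ∎
      upper : n ≤ 3 * (n / 3) + 2
      upper = begin
        n                      ≡⟨ m≡m%n+[m/n]*n n 3 ⟩
        n % 3 + n / 3 * 3      ≤⟨ +-monoˡ-≤ (n / 3 * 3) (≤-pred (m%n<n n 3)) ⟩
        2 + n / 3 * 3          ≡⟨ +-comm 2 (n / 3 * 3) ⟩
        n / 3 * 3 + 2          ≡⟨ cong (_+ 2) (*-comm (n / 3) 3) ⟩
        3 * (n / 3) + 2        ∎

  upper-bound : ∀ D n → threshold D ≤ n → (G : OGraph n) → 9 * D * countH G ≤ (4 * D + 9) * (n C 4)
  upper-bound D n N≤n G = upper-estimate D n (countH G)
    (≤-trans (+-monoˡ-≤ 54 (*-monoˡ-≤ D (≤ᵇ⇒≤ 24 93 _))) (93D+54≤9n D n N≤n)) (54*countH≤n⁴ G)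

  lower-bound : ∀ D n → threshold D ≤ n → 4 * D * (n C 4) ≤ 9 * D * countH (balancedBlowUp n) + 9 * (n C 4)
  lower-bound D n N≤n with 3m≤n , n≤3m+2 ← thirds n =
    lower-estimate D n (n / 3) (countH (balancedBlowUp n)) (93D+54≤9n D n N≤n) 3m≤n n≤3m+2 (3m⁴≤2*countH+3m³ (n / 3) n 3m≤n)


module RationalBounds where
  open import Data.Empty using (⊥-elim)
  open import Data.Integer as ℤ using (+_; +0; +[1+_]; -[1+_]; +≤+)
  import Data.Integer.Properties as ℤ
  open import Data.Integer.Tactic.RingSolver using (solve-∀)
  open import Data.Nat as ℕ using (ℕ; suc)
  import Data.Nat.Properties as ℕ
  import Data.Nat.Tactic.RingSolver as ℕ
  open import Data.Rational using (mkℚ; _/_; _+_; _-_; -_; _*_; _≤_; _<_; 0ℚ; toℚᵘ; ↧ₙ_; positive)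
  open import Data.Rational.Properties using (toℚᵘ-cancel-≤; toℚᵘ-fromℚᵘ; toℚᵘ-homo-+; toℚᵘ-homo-*)
  open import Data.Rational.Unnormalised as ℚᵘ using (mkℚᵘ; *≤*)
  import Data.Rational.Unnormalised.Properties as ℚᵘ
  open import Relation.Binary.PropositionalEquality using (_≡_; cong; cong₂; trans)

  toℚᵘ-ℕtoℚ : ∀ x → toℚᵘ (ℕtoℚ x) ℚᵘ.≃ mkℚᵘ (+ x) 0
  toℚᵘ-ℕtoℚ x = toℚᵘ-fromℚᵘ (mkℚᵘ (+ x) 0)

  toℚᵘ-[q+ε]*ℕtoℚ : ∀ a b ε y → toℚᵘ ((+ a / suc b + ε) * ℕtoℚ y) ℚᵘ.≃ (mkℚᵘ (+ a) b ℚᵘ.+ toℚᵘ ε) ℚᵘ.* mkℚᵘ (+ y) 0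
  toℚᵘ-[q+ε]*ℕtoℚ a b ε y = ℚᵘ.≃-trans (toℚᵘ-homo-* (+ a / suc b + ε) (ℕtoℚ y))
    (ℚᵘ.*-cong (ℚᵘ.≃-trans (toℚᵘ-homo-+ (+ a / suc b) ε) (ℚᵘ.+-congˡ (toℚᵘ ε) (toℚᵘ-fromℚᵘ (mkℚᵘ (+ a) b)))) (toℚᵘ-ℕtoℚ y))

  private
    pos-+-* : ∀ m n p q → + (m ℕ.* n ℕ.+ p ℕ.* q) ≡ + m ℤ.* + n ℤ.+ + p ℤ.* + q
    pos-+-* m n p q = trans (ℤ.pos-+ (m ℕ.* n) (p ℕ.* q)) (cong₂ ℤ._+_ (ℤ.pos-* m n) (ℤ.pos-* p q))

    pos-*-* : ∀ m n p → + (m ℕ.* n ℕ.* p) ≡ + m ℤ.* + n ℤ.* + p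
    pos-*-* m n p = trans (ℤ.pos-* (m ℕ.* n) p) (cong (ℤ._* + p) (ℤ.pos-* m n))

    i≤j+k⇒i-k≤j : ∀ {i j} k → i ℤ.≤ j ℤ.+ k → i ℤ.- k ℤ.≤ j
    i≤j+k⇒i-k≤j {i} {j} k i≤j+k = ℤ.≤-trans (ℤ.+-monoˡ-≤ (ℤ.- k) i≤j+k) (ℤ.≤-reflexive (cancel j k))
      where
      cancel : ∀ j k → j ℤ.+ k ℤ.- k ≡ j
      cancel = solve-∀

    cross-upper : ∀ a b k d x y → suc b ℕ.* suc d ℕ.* x ℕ.≤ (a ℕ.* suc d ℕ.+ suc k ℕ.* suc b) ℕ.* y →
      + x ℤ.* + (suc b ℕ.* suc d ℕ.* 1) ℤ.≤ (+ a ℤ.* + suc d ℤ.+ + suc k ℤ.* + suc b) ℤ.* + y ℤ.* + 1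
    cross-upper a b k d x y h = begin
      + x ℤ.* + (suc b ℕ.* suc d ℕ.* 1)                  ≡⟨ ℤ.pos-* x (suc b ℕ.* suc d ℕ.* 1) ⟨
      + (x ℕ.* (suc b ℕ.* suc d ℕ.* 1))                  ≡⟨ cong +_ (rearrange (suc b) (suc d) x) ⟩
      + (suc b ℕ.* suc d ℕ.* x)                          ≤⟨ +≤+ h ⟩
      + ((a ℕ.* suc d ℕ.+ suc k ℕ.* suc b) ℕ.* y)        ≡⟨ ℤ.pos-* (a ℕ.* suc d ℕ.+ suc k ℕ.* suc b) y ⟩
      + (a ℕ.* suc d ℕ.+ suc k ℕ.* suc b) ℤ.* + y        ≡⟨ cong (ℤ._* + y) (pos-+-* a (suc d) (suc k) (suc b)) ⟩
      (+ a ℤ.* + suc d ℤ.+ + suc k ℤ.* + suc b) ℤ.* + y  ≡⟨ ℤ.*-identityʳ _ ⟨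
      (+ a ℤ.* + suc d ℤ.+ + suc k ℤ.* + suc b) ℤ.* + y ℤ.* + 1 ∎
      where
      open ℤ.≤-Reasoning
      rearrange : ∀ b d x → x ℕ.* (b ℕ.* d ℕ.* 1) ≡ b ℕ.* d ℕ.* x
      rearrange = ℕ.solve-∀

    cross-lower : ∀ a b k d x y → a ℕ.* suc d ℕ.* y ℕ.≤ suc b ℕ.* suc d ℕ.* x ℕ.+ suc k ℕ.* suc b ℕ.* y →
      (+ a ℤ.* + suc d ℤ.+ -[1+ k ] ℤ.* + suc b) ℤ.* + y ℤ.* + 1 ℤ.≤ + x ℤ.* + (suc b ℕ.* suc d ℕ.* 1)
    cross-lower a b k d x y h = begin
      (+ a ℤ.* + suc d ℤ.+ ℤ.- (+ suc k) ℤ.* + suc b) ℤ.* + y ℤ.* + 1 ≡⟨ ℤ.*-identityʳ _ ⟩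
      (+ a ℤ.* + suc d ℤ.+ ℤ.- (+ suc k) ℤ.* + suc b) ℤ.* + y         ≡⟨ expand (+ a) (+ suc b) (+ suc k) (+ suc d) (+ y) ⟩
      + a ℤ.* + suc d ℤ.* + y ℤ.- + suc k ℤ.* + suc b ℤ.* + y          ≡⟨ cong₂ ℤ._-_ (pos-*-* a (suc d) y) (pos-*-* (suc k) (suc b) y) ⟨
      + (a ℕ.* suc d ℕ.* y) ℤ.- + (suc k ℕ.* suc b ℕ.* y)              ≤⟨ i≤j+k⇒i-k≤j (+ (suc k ℕ.* suc b ℕ.* y)) h′ ⟩
      + (suc b ℕ.* suc d ℕ.* x)                                        ≡⟨ cong +_ (rearrange (suc b) (suc d) x) ⟩
      + (x ℕ.* (suc b ℕ.* suc d ℕ.* 1))                                ≡⟨ ℤ.pos-* x (suc b ℕ.* suc d ℕ.* 1) ⟩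
      + x ℤ.* + (suc b ℕ.* suc d ℕ.* 1)                                ∎
      where
      open ℤ.≤-Reasoning
      h′ : + (a ℕ.* suc d ℕ.* y) ℤ.≤ + (suc b ℕ.* suc d ℕ.* x) ℤ.+ + (suc k ℕ.* suc b ℕ.* y)
      h′ = ℤ.≤-trans (+≤+ h) (ℤ.≤-reflexive (ℤ.pos-+ (suc b ℕ.* suc d ℕ.* x) (suc k ℕ.* suc b ℕ.* y)))
      expand : ∀ a b k d y → (a ℤ.* d ℤ.+ ℤ.- k ℤ.* b) ℤ.* y ≡ a ℤ.* d ℤ.* y ℤ.- k ℤ.* b ℤ.* y
      expand = solve-∀
      rearrange : ∀ b d x → b ℕ.* d ℕ.* x ≡ x ℕ.* (b ℕ.* d ℕ.* 1)
      rearrange = ℕ.solve-∀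

  -- Since ε ≥ 1 / ↧ₙ ε, it suffices to compare with q ± 1 / ↧ₙ ε; the hypotheses are these comparisons with denominators cleared.
  ℕtoℚ≤[q+ε]*ℕtoℚ : ∀ a b ε → 0ℚ < ε → ∀ x y →
    suc b ℕ.* ↧ₙ ε ℕ.* x ℕ.≤ (a ℕ.* ↧ₙ ε ℕ.+ suc b) ℕ.* y → ℕtoℚ x ≤ (+ a / suc b + ε) * ℕtoℚ y
  ℕtoℚ≤[q+ε]*ℕtoℚ a b ε@(mkℚ +[1+ k ] d _) _ x y h =
    toℚᵘ-cancel-≤ (ℚᵘ.≤-respˡ-≃ (ℚᵘ.≃-sym (toℚᵘ-ℕtoℚ x)) (ℚᵘ.≤-respʳ-≃ (ℚᵘ.≃-sym (toℚᵘ-[q+ε]*ℕtoℚ a b ε y))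
      (*≤* (cross-upper a b k d x y (ℕ.≤-trans h (ℕ.*-monoˡ-≤ y (ℕ.+-monoʳ-≤ (a ℕ.* suc d) (ℕ.m≤n*m (suc b) (suc k)))))))))
  ℕtoℚ≤[q+ε]*ℕtoℚ a b (mkℚ +0       _ _) 0<ε = ⊥-elim (ℤ.Positive.pos (positive 0<ε))
  ℕtoℚ≤[q+ε]*ℕtoℚ a b (mkℚ -[1+ _ ] _ _) 0<ε = ⊥-elim (ℤ.Positive.pos (positive 0<ε))

  [q-ε]*ℕtoℚ≤ℕtoℚ : ∀ a b ε → 0ℚ < ε → ∀ x y →
    a ℕ.* ↧ₙ ε ℕ.* y ℕ.≤ suc b ℕ.* ↧ₙ ε ℕ.* x ℕ.+ suc b ℕ.* y → (+ a / suc b - ε) * ℕtoℚ y ≤ ℕtoℚ x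
  [q-ε]*ℕtoℚ≤ℕtoℚ a b ε@(mkℚ +[1+ k ] d _) _ x y h =
    toℚᵘ-cancel-≤ (ℚᵘ.≤-respʳ-≃ (ℚᵘ.≃-sym (toℚᵘ-ℕtoℚ x)) (ℚᵘ.≤-respˡ-≃ (ℚᵘ.≃-sym (toℚᵘ-[q+ε]*ℕtoℚ a b (- ε) y))
      (*≤* (cross-lower a b k d x y (ℕ.≤-trans h (ℕ.+-monoʳ-≤ (suc b ℕ.* suc d ℕ.* x) (ℕ.*-monoˡ-≤ y (ℕ.m≤n*m (suc b) (suc k)))))))))
  [q-ε]*ℕtoℚ≤ℕtoℚ a b (mkℚ +0       _ _) 0<ε = ⊥-elim (ℤ.Positive.pos (positive 0<ε))
  [q-ε]*ℕtoℚ≤ℕtoℚ a b (mkℚ -[1+ _ ] _ _) 0<ε = ⊥-elim (ℤ.Positive.pos (positive 0<ε))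


open import Data.Nat using (ℕ; _≥_)
open import Data.Nat.Combinatorics using (_C_)
open import Data.Integer using (+_)
open import Data.Rational using (ℚ; _/_; _+_; _-_; _*_; _≤_; _<_; 0ℚ; ↧ₙ_)
open import Data.Product using (_×_; Σ; _,_)
open Bounds
open RationalBounds

mainTheorem6 : (ε : ℚ) → 0ℚ < ε →
    Σ ℕ (λ N → (n : ℕ) → n ≥ N →
      ((G : OGraph n) → ℕtoℚ (countH G) ≤ ((+ 4 / 9) + ε) * ℕtoℚ (n C 4))
      × Σ (OGraph n) (λ G → ((+ 4 / 9) - ε) * ℕtoℚ (n C 4) ≤ ℕtoℚ (countH G)))
mainTheorem6 ε 0<ε = threshold (↧ₙ ε) , λ n n≥N →
  (λ G → ℕtoℚ≤[q+ε]*ℕtoℚ 4 8 ε 0<ε (countH G) (n C 4) (upper-bound (↧ₙ ε) n n≥N G)) ,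
  (balancedBlowUp n , [q-ε]*ℕtoℚ≤ℕtoℚ 4 8 ε 0<ε (countH (balancedBlowUp n)) (n C 4) (lower-bound (↧ₙ ε) n n≥N))
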